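{- A function $h\colon\operatorname{AdS}_n\to\mathbb{Z}$ is equal to $h_D$ for some delta-matroid $D$ on $[n,\overline n]$ if and only if (1) $h(\emptyset)=0$; (2) $h(S)\in\{0,1\}$ whenever $|S|=1$; (3) $h(S)+h(T)\ge h(S\cap T)+h(S\sqcup T)+|S\cap\overline T|$ for all $S,T\in\operatorname{AdS}_n$.
   Context: Let $[n,\overline{n}]=\{1,\dots,n,\overline{1},\dots,\overline{n}\}$ with involution $a\mapsto\overline a$; $\overline S=\{\overline a:a\in S\}$. Admissible sets contain at most one of $i,\overline i$ for each $i$; $\operatorname{AdS}_n$ is their set. $S\sqcup T=\{a\in S\cup T:\overline a\notin S\cup T\}$. A delta-matroid on $[n,\overline n]$ is a non-empty collection $\mathcal F$ of admissible sets of size $n$ (feasible sets) such that $\operatorname{Conv}\{e_B:B\in\mathcal F\}$ has all edges parallel to some $e_i$ or $e_i\pm e_j$ ($e_{\overline i}=-e_i$, $e_S=\sum_{a\in S}e_a$). Its rank function is $g_D(S)=\max_{B\in\mathcal F}(|S\cap B|-|\overline S\cap B|)$, and $h_D(S)=\frac{g_D(S)+|S|}{2}$. -}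

module Defs where

open import Data.Nat as ℕ using (ℕ; zero; suc)
open import Data.Integer as ℤ using (ℤ; +_; _-_; _*_; _≤_)
open import Data.Bool using (Bool; true; false; not; if_then_else_)
open import Data.Maybe using (Maybe; just; nothing)
import Data.Maybe as Maybe
open import Data.Vec using (Vec; []; _∷_; replicate; map; zipWith; foldr; tabulate)
open import Data.Fin using (Fin)
open import Data.Product using (Σ; ∃; ∃-syntax; _×_; _,_)
open import Data.Sum using (_⊎_)
open import Relation.Binary.PropositionalEquality using (_≡_; _≢_)
open import Data.Fin using () renaming (_≟_ to _≟ᶠ_)
open import Relation.Nullary using (yes; no)

-- An admissible subset S of [n, n̄] is encoded as a vector of length n
-- whose i-th entry is
--   nothing     if neither i nor ī lies in S,
--   just true   if i ∈ S,
--   just false  if ī ∈ S.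
-- This is a bijection AdS_n ≅ Vec (Maybe Bool) n.

AdS : ℕ → Set
AdS n = Vec (Maybe Bool) n

-- Admissible sets of size n: exactly one of i, ī for every i.
Full : ℕ → Set
Full n = Vec Bool n

toAdS : ∀ {n} → Full n → AdS n
toAdS = map just

∅ : ∀ {n} → AdS n
∅ = replicate _ nothing

card : ∀ {n} → AdS n → ℕ
card = foldr _ (λ x k → Maybe.maybe (λ _ → suc k) k x) 0

bar : ∀ {n} → AdS n → AdS n
bar = map (Maybe.map not)

∩₁ : Maybe Bool → Maybe Bool → Maybe Bool
∩₁ (just true)  (just true)  = just true
∩₁ (just false) (just false) = just false
∩₁ _ _ = nothing

_∩_ : ∀ {n} → AdS n → AdS n → AdS n
_∩_ = zipWith ∩₁

-- S ⊔ T = {a ∈ S ∪ T : ā ∉ S ∪ T}, coordinatewise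
⊔₁ : Maybe Bool → Maybe Bool → Maybe Bool
⊔₁ nothing      y            = y
⊔₁ (just x)     nothing      = just x
⊔₁ (just true)  (just true)  = just true
⊔₁ (just false) (just false) = just false
⊔₁ (just _)     (just _)     = nothing

_⊔_ : ∀ {n} → AdS n → AdS n → AdS n
_⊔_ = zipWith ⊔₁

sumℤ : ∀ {n} → Vec ℤ n → ℤ
sumℤ = foldr _ ℤ._+_ (+ 0)

_·_ : ∀ {n} → Vec ℤ n → Vec ℤ n → ℤ
u · v = sumℤ (zipWith _*_ u v)

unit : ∀ {n} → Fin n → Vec ℤ n
unit i = tabulate (λ k → if Relation.Nullary.Decidable.⌊ k ≟ᶠ i ⌋ then + 1 else + 0)
  where import Relation.Nullary.Decidable

-- e_B for B of size n  (e_i for i ∈ B, e_ī = - e_i for ī ∈ B)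
eB : ∀ {n} → Full n → Vec ℤ n
eB = map (λ b → if b then + 1 else ℤ.- (+ 1))

Parallel : ∀ {n} → Vec ℤ n → Vec ℤ n → Set
Parallel u v = Σ ℤ λ a → Σ ℤ λ b → a ≢ + 0 × b ≢ + 0 ×
  (map (a *_) u ≡ map (b *_) v)

-- Delta-matroids.
-- A collection of feasible sets is a predicate F : Full n → Bool
-- (a subset of the finite set of admissible n-sets).

Feasible : ∀ {n} → (Full n → Bool) → Full n → Set
Feasible F B = F B ≡ true

-- {e_B, e_B'} (B ≠ B') spans an edge of Conv{e_C : C ∈ F}: some linear
-- functional w attains its maximum over the polytope exactly at the
-- vertices e_B and e_B'.  (Integral w suffice since the polytope is
-- integral.)
IsEdge : ∀ {n} → (Full n → Bool) → Full n → Full n → Set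
IsEdge {n} F B B' =
  Feasible F B × Feasible F B' × B ≢ B' ×
  Σ (Vec ℤ n) λ w →
    (∀ C → Feasible F C → (w · eB C) ≤ (w · eB B)) ×
    (w · eB B ≡ w · eB B') ×
    (∀ C → Feasible F C → w · eB C ≡ w · eB B → C ≡ B ⊎ C ≡ B')

IsDeltaMatroid : ∀ {n} → (Full n → Bool) → Set
IsDeltaMatroid {n} F =
  (∃ λ B → Feasible F B) ×
  (∀ B B' → IsEdge F B B' →
     ∃[ i ] ∃[ j ] (Parallel (zipWith _-_ (eB B) (eB B')) (unit i)
                   ⊎ Parallel (zipWith _-_ (eB B) (eB B')) (zipWith ℤ._+_ (unit i) (unit j))
                   ⊎ Parallel (zipWith _-_ (eB B) (eB B')) (zipWith _-_ (unit i) (unit j))))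

pairing : ∀ {n} → AdS n → Full n → ℤ
pairing S B = + card (S ∩ toAdS B) - + card (bar S ∩ toAdS B)

IsRankValue : ∀ {n} → (Full n → Bool) → AdS n → ℤ → Set
IsRankValue F S g =
  (∃ λ B → Feasible F B × pairing S B ≡ g) ×
  (∀ B → Feasible F B → pairing S B ≤ g)

IsHValue : ∀ {n} → (Full n → Bool) → AdS n → ℤ → Set
IsHValue F S v = ∃ λ g → IsRankValue F S g × (+ 2 * v ≡ g ℤ.+ + card S)

-- Since 2 h_D(S) = g_D(S) + |S|, h_D(S) is the largest overlap |S ∩ B| of S with a basis B, and the modular
-- identity |S∩T ∩ B| + |S⊔T ∩ B| + |S ∩ T̄| = |S ∩ B| + |T ∩ B| turns axiom (3) into the statement that some
-- basis maximises |S∩T ∩ B| and |S⊔T ∩ B| at once. For a delta-matroid a basis maximising their sum does: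
-- a vertex of the basis polytope that does not maximise a linear functional has an improving edge, an edge
-- changes at most two coordinates, and such a change cannot raise one overlap without raising the sum.
-- Conversely, for h satisfying (1)-(3) take as bases the B with |T ∩ B| ≤ h(T) for all T. A greedy
-- construction through deletion and contraction of the first coordinate shows that each h(S) is attained,
-- these bases satisfy symmetric exchange, and exchanging from both ends of an edge of their polytope shows
-- that the edge changes at most two coordinates.

module Submission where

open import Defs
open import Data.Bool as Bool using (Bool; true; false; not; if_then_else_)
import Data.Bool.Properties as BoolP
open import Data.Empty using (⊥; ⊥-elim)
open import Data.Fin as Fin using (Fin)
import Data.Fin.Properties as FinP
open import Data.Integer as ℤ using (ℤ; +_; -[1+_]; _+_; _-_; _*_; -_; _≤_; _<_; +≤+; +<+)
import Data.Integer.Properties as ℤP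
open import Data.Integer.Tactic.RingSolver using (solve-∀)
open import Data.List as List using (List; []; _∷_; _++_)
open import Data.List.Membership.Propositional using (_∈_)
open import Data.List.Membership.Propositional.Properties using (∈-map⁺; ∈-++⁺ˡ; ∈-++⁺ʳ; ∈-allFin)
import Data.List.Relation.Unary.All as All
open import Data.List.Relation.Unary.All.Properties using (¬All⇒Any¬)
open import Data.List.Relation.Unary.Any as Any using (here; there)
open import Data.Maybe as Maybe using (Maybe; just; nothing)
import Data.Maybe.Properties as MaybeP
open import Data.Nat as ℕ using (ℕ; zero; suc)
import Data.Nat.Properties as ℕP
import Data.Nat.Tactic.RingSolver as ℕ-Solver
open import Data.Product using (Σ; ∃; ∃-syntax; _×_; _,_; proj₁; proj₂)
open import Data.Sum as Sum using (_⊎_; inj₁; inj₂; reduce; [_,_]′)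
open import Data.Unit using (⊤; tt)
open import Data.Vec using (Vec; []; _∷_; lookup; map; zipWith; _[_]≔_)
import Data.Vec.Properties as VecP
open import Data.Vec.Relation.Binary.Pointwise.Extensional using (ext; Pointwise-≡⇒≡)
open import Function.Bundles using (_⇔_; mk⇔; Equivalence)
open import Relation.Binary.PropositionalEquality
  using (_≡_; _≢_; refl; sym; trans; cong; cong₂; subst; subst₂; ≢-sym; module ≡-Reasoning)
open import Relation.Nullary using (¬_; Dec; yes; no; _×-dec_; _⊎-dec_; _→-dec_; ¬?)
open import Relation.Nullary.Decidable using (⌊_⌋; isYes; toWitness; fromWitness; map′; from-yes)
open import Relation.Unary using (Decidable)
import Algebra.Properties.CommutativeSemigroup as CommutativeSemigroupProperties

module ℕ-+ = CommutativeSemigroupProperties ℕP.+-commutativeSemigroup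
module ℤ-+ = CommutativeSemigroupProperties ℤP.+-commutativeSemigroup

i+j-j≡i : ∀ i j → i + j - j ≡ i
i+j-j≡i = solve-∀

i-j+j≡i : ∀ i j → i - j + j ≡ i
i-j+j≡i = solve-∀

i+j-i≡j : ∀ i j → i + j - i ≡ j
i+j-i≡j = solve-∀

i+[j-i]≡j : ∀ i j → i + (j - i) ≡ j
i+[j-i]≡j = solve-∀

+-cancelʳ-≤ : ∀ k {i j} → i + k ≤ j + k → i ≤ j
+-cancelʳ-≤ k {i} {j} le = subst₂ _≤_ (i+j-j≡i i k) (i+j-j≡i j k) (ℤP.+-monoˡ-≤ (- k) le)

+-cancelʳ-< : ∀ k {i j} → i + k < j + k → i < j
+-cancelʳ-< k {i} {j} lt = subst₂ _<_ (i+j-j≡i i k) (i+j-j≡i j k) (ℤP.+-monoˡ-< (- k) lt)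

i≤j+k⇒i-k≤j : ∀ {i j k} → i ≤ j + k → i - k ≤ j
i≤j+k⇒i-k≤j {i} {j} {k} le = subst (i - k ≤_) (i+j-j≡i j k) (ℤP.+-monoˡ-≤ (- k) le)

i+i+1≤j+k→k≤i+1⇒i≤j : ∀ {i j k} → i + i + + 1 ≤ j + k → k ≤ i + + 1 → i ≤ j
i+i+1≤j+k→k≤i+1⇒i≤j {i} {j} {k} le k≤i+1 = +-cancelʳ-≤ (i + + 1) (begin
  i + (i + + 1)  ≡⟨ ℤP.+-assoc i i (+ 1) ⟨
  i + i + + 1    ≤⟨ le ⟩
  j + k          ≤⟨ ℤP.+-monoʳ-≤ j k≤i+1 ⟩
  j + (i + + 1)  ∎)
  where open ℤP.≤-Reasoning

0+i+0≡i : ∀ i → + 0 + i + + 0 ≡ i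
0+i+0≡i = solve-∀

pos-+₃ : ∀ a b c → + (a ℕ.+ b ℕ.+ c) ≡ + a + + b + + c
pos-+₃ a b c = trans (ℤP.pos-+ (a ℕ.+ b) c) (cong (_+ + c) (ℤP.pos-+ a b))

0≤i≤1⇒i∈01 : ∀ {i} → + 0 ≤ i → i ≤ + 1 → i ≡ + 0 ⊎ i ≡ + 1
0≤i≤1⇒i∈01 {+ 0}           _ _                  = inj₁ refl
0≤i≤1⇒i∈01 {+ 1}           _ _                  = inj₂ refl
0≤i≤1⇒i∈01 {+ suc (suc _)} _ (+≤+ (ℕ.s≤s ()))

i≤j≤i+1⇒j-i∈01 : ∀ {i j} → i ≤ j → j ≤ i + + 1 → j - i ≡ + 0 ⊎ j - i ≡ + 1
i≤j≤i+1⇒j-i∈01 {i} {j} i≤j j≤i+1 = 0≤i≤1⇒i∈01 (ℤP.i≤j⇒0≤j-i i≤j)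
  (subst (j - i ≤_) (i+j-i≡j i (+ 1)) (ℤP.+-monoˡ-≤ (- i) j≤i+1))

0≤i<1⇒i≡0 : ∀ {i} → + 0 ≤ i → i < + 1 → i ≡ + 0
0≤i<1⇒i≡0 (+≤+ _) (+<+ (ℕ.s≤s ℕ.z≤n)) = refl

0≤i<j≤0⇒⊥ : ∀ {i j} → + 0 ≤ i → i < j → j ≤ + 0 → ⊥
0≤i<j≤0⇒⊥ 0≤i i<j j≤0 = ℤP.<-irrefl refl (ℤP.≤-<-trans 0≤i (ℤP.<-≤-trans i<j j≤0))

0≤i→0≤j→i+j≤0⇒i≡0∧j≡0 : ∀ {i j} → + 0 ≤ i → + 0 ≤ j → i + j ≤ + 0 → i ≡ + 0 × j ≡ + 0
0≤i→0≤j→i+j≤0⇒i≡0∧j≡0 {i} {j} 0≤i 0≤j i+j≤0 =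
  ℤP.≤-antisym (ℤP.≤-trans (ℤP.i≤i+j i j {{ℤ.nonNegative 0≤j}}) i+j≤0) 0≤i ,
  ℤP.≤-antisym (ℤP.≤-trans (ℤP.i≤j+i j i {{ℤ.nonNegative 0≤i}}) i+j≤0) 0≤j

0≤i→i≢0⇒1≤i : ∀ {i} → + 0 ≤ i → i ≢ + 0 → + 1 ≤ i
0≤i→i≢0⇒1≤i {+ 0}     _ i≢0 = ⊥-elim (i≢0 refl)
0≤i→i≢0⇒1≤i {+ suc _} _ _   = +≤+ (ℕ.s≤s ℕ.z≤n)

i+j<i⇒j<0 : ∀ {i j} → i + j < i → j < + 0
i+j<i⇒j<0 {i} {j} lt = subst₂ _<_ (i+j-i≡j i j) (ℤP.+-inverseʳ i) (ℤP.+-monoˡ-< (- i) lt)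

+a≡+b+δ⇒b<a⇒0<δ : ∀ {a b δ} → + a ≡ + b + δ → b ℕ.< a → + 0 < δ
+a≡+b+δ⇒b<a⇒0<δ {a} {b} {δ} e b<a =
  +-cancelʳ-< (+ b) (subst₂ _<_ (sym (ℤP.+-identityˡ (+ b))) (trans e (ℤP.+-comm (+ b) δ)) (+<+ b<a))

+a≡+b+δ⇒0<δ⇒b<a : ∀ {a b δ} → + a ≡ + b + δ → + 0 < δ → b ℕ.< a
+a≡+b+δ⇒0<δ⇒b<a {a} {b} {δ} e 0<δ =
  ℤP.drop‿+<+ (subst₂ _<_ (ℤP.+-identityʳ (+ b)) (sym e) (ℤP.+-monoʳ-< (+ b) 0<δ))

record Enumeration (A : Set) : Set where
  field
    elements : List A
    complete : ∀ x → x ∈ elements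
open Enumeration

enumFin : ∀ n → Enumeration (Fin n)
enumFin n = record { elements = List.allFin n ; complete = ∈-allFin }

enumFull : ∀ n → Enumeration (Full n)
enumFull zero    = record { elements = [] ∷ [] ; complete = λ { [] → here refl } }
enumFull (suc n) = record { elements = List.map (true ∷_) xs ++ List.map (false ∷_) xs ; complete = complete′ }
  where
  xs = elements (enumFull n)
  complete′ : ∀ B → B ∈ List.map (true ∷_) xs ++ List.map (false ∷_) xs
  complete′ (true ∷ B)  = ∈-++⁺ˡ (∈-map⁺ (true ∷_) (complete (enumFull n) B))
  complete′ (false ∷ B) = ∈-++⁺ʳ (List.map (true ∷_) xs) (∈-map⁺ (false ∷_) (complete (enumFull n) B))

enumAdS : ∀ n → Enumeration (AdS n)
enumAdS zero    = record { elements = [] ∷ [] ; complete = λ { [] → here refl } }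
enumAdS (suc n) = record { elements = with₀ ++ with₊ ++ with₋ ; complete = complete′ }
  where
  xs  = elements (enumAdS n)
  with₀ = List.map (nothing ∷_) xs
  with₊ = List.map (just true ∷_) xs
  with₋ = List.map (just false ∷_) xs
  complete′ : ∀ S → S ∈ with₀ ++ with₊ ++ with₋
  complete′ (nothing ∷ S)    = ∈-++⁺ˡ (∈-map⁺ (nothing ∷_) (complete (enumAdS n) S))
  complete′ (just true ∷ S)  = ∈-++⁺ʳ with₀ (∈-++⁺ˡ (∈-map⁺ (just true ∷_) (complete (enumAdS n) S)))
  complete′ (just false ∷ S) = ∈-++⁺ʳ with₀ (∈-++⁺ʳ with₊ (∈-map⁺ (just false ∷_) (complete (enumAdS n) S)))

all-or-counterexample : ∀ {A : Set} {P : A → Set} → Enumeration A → Decidable P →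
  (∀ x → P x) ⊎ ∃ λ x → ¬ P x
all-or-counterexample E P? with All.all? P? (elements E)
... | yes all = inj₁ λ x → All.lookup all (complete E x)
... | no ¬all = inj₂ (Any.satisfied (¬All⇒Any¬ P? _ ¬all))

all? : ∀ {A : Set} {P : A → Set} → Enumeration A → Decidable P → Dec (∀ x → P x)
all? E P? = map′ (λ all x → All.lookup all (complete E x)) (λ all → All.tabulate λ {x} _ → all x)
                 (All.all? P? (elements E))

module _ {A : Set} {P : A → Set} (P? : Decidable P) (_≼_ : A → A → Set)
         (≼-total : ∀ {x y} → P x → P y → x ≼ y ⊎ y ≼ x)
         (≼-trans : ∀ {x y z} → P x → P y → P z → x ≼ y → y ≼ z → x ≼ z) where

  private
    ≼-refl : ∀ {x} → P x → x ≼ x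
    ≼-refl px = reduce (≼-total px px)

    LeastIn : List A → A → Set
    LeastIn xs x = P x × ∀ y → y ∈ xs → P y → x ≼ y

    least-in : (xs : List A) → (∀ y → y ∈ xs → ¬ P y) ⊎ ∃ (LeastIn xs)
    least-in [] = inj₁ λ _ ()
    least-in (z ∷ zs) with P? z | least-in zs
    ... | no ¬pz | inj₁ none = inj₁ λ { y (here refl) → ¬pz ; y (there y∈) → none y y∈ }
    ... | no ¬pz | inj₂ (x , px , least) =
      inj₂ (x , px , λ { y (here refl) pz → ⊥-elim (¬pz pz) ; y (there y∈) → least y y∈ })
    ... | yes pz | inj₁ none =
      inj₂ (z , pz , λ { y (here refl) _ → ≼-refl pz ; y (there y∈) py → ⊥-elim (none y y∈ py) })
    ... | yes pz | inj₂ (x , px , least) with ≼-total px pz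
    ...   | inj₁ x≼z = inj₂ (x , px , λ { y (here refl) _ → x≼z ; y (there y∈) → least y y∈ })
    ...   | inj₂ z≼x = inj₂ (z , pz , λ { y (here refl) _ → ≼-refl pz
                                         ; y (there y∈) py → ≼-trans pz px py z≼x (least y y∈ py) })

  least : Enumeration A → ∃ P → ∃ λ x → P x × ∀ y → P y → x ≼ y
  least E (w , pw) with least-in (elements E)
  ... | inj₁ none              = ⊥-elim (none w (complete E w) pw)
  ... | inj₂ (x , px , least′) = x , px , λ y → least′ y (complete E y)

hit : Maybe Bool → Bool → ℕ
hit nothing      _     = 0
hit (just true)  true  = 1
hit (just true)  false = 0
hit (just false) true  = 0
hit (just false) false = 1

size : Maybe Bool → ℕ
size nothing  = 0
size (just _) = 1

hit-self : ∀ b → hit (just b) b ≡ 1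
hit-self true  = refl
hit-self false = refl

hit-other : ∀ s b → s ≢ just b → hit s b ≡ 0
hit-other nothing      _     _   = refl
hit-other (just true)  true  s≢ = ⊥-elim (s≢ refl)
hit-other (just true)  false _   = refl
hit-other (just false) true  _   = refl
hit-other (just false) false s≢ = ⊥-elim (s≢ refl)

hit-+-bar : ∀ s b → hit s b ℕ.+ hit (Maybe.map not s) b ≡ size s
hit-+-bar nothing      _     = refl
hit-+-bar (just true)  true  = refl
hit-+-bar (just true)  false = refl
hit-+-bar (just false) true  = refl
hit-+-bar (just false) false = refl

hit-modular : ∀ s t b →
  hit (∩₁ s t) b ℕ.+ hit (⊔₁ s t) b ℕ.+ size (∩₁ s (Maybe.map not t)) ≡ hit s b ℕ.+ hit t b
hit-modular nothing      nothing      _     = refl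
hit-modular nothing      (just true)  true  = refl
hit-modular nothing      (just true)  false = refl
hit-modular nothing      (just false) true  = refl
hit-modular nothing      (just false) false = refl
hit-modular (just true)  nothing      true  = refl
hit-modular (just true)  nothing      false = refl
hit-modular (just false) nothing      true  = refl
hit-modular (just false) nothing      false = refl
hit-modular (just true)  (just true)  true  = refl
hit-modular (just true)  (just true)  false = refl
hit-modular (just true)  (just false) true  = refl
hit-modular (just true)  (just false) false = refl
hit-modular (just false) (just true)  true  = refl
hit-modular (just false) (just true)  false = refl
hit-modular (just false) (just false) true  = refl
hit-modular (just false) (just false) false = refl

∩₁-idem : ∀ s → ∩₁ s s ≡ s
∩₁-idem nothing      = refl
∩₁-idem (just true)  = refl
∩₁-idem (just false) = refl

⊔₁-idem : ∀ s → ⊔₁ s s ≡ s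
⊔₁-idem nothing      = refl
⊔₁-idem (just true)  = refl
⊔₁-idem (just false) = refl

∩₁-zeroʳ : ∀ s → ∩₁ s nothing ≡ nothing
∩₁-zeroʳ nothing      = refl
∩₁-zeroʳ (just true)  = refl
∩₁-zeroʳ (just false) = refl

⊔₁-identityʳ : ∀ s → ⊔₁ s nothing ≡ s
⊔₁-identityʳ nothing  = refl
⊔₁-identityʳ (just _) = refl

∩₁-inverseʳ : ∀ b → ∩₁ (just b) (just (not b)) ≡ nothing
∩₁-inverseʳ true  = refl
∩₁-inverseʳ false = refl

⊔₁-inverseʳ : ∀ b → ⊔₁ (just b) (just (not b)) ≡ nothing
⊔₁-inverseʳ true  = refl
⊔₁-inverseʳ false = refl

∩₁-inverseˡ : ∀ b → ∩₁ (just (not b)) (just b) ≡ nothing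
∩₁-inverseˡ true  = refl
∩₁-inverseˡ false = refl

⊔₁-inverseˡ : ∀ b → ⊔₁ (just (not b)) (just b) ≡ nothing
⊔₁-inverseˡ true  = refl
⊔₁-inverseˡ false = refl

size-∩₁≤ : ∀ s t → size (∩₁ s t) ℕ.≤ size t
size-∩₁≤ nothing      nothing      = ℕ.z≤n
size-∩₁≤ nothing      (just _)     = ℕ.z≤n
size-∩₁≤ (just true)  nothing      = ℕ.z≤n
size-∩₁≤ (just false) nothing      = ℕ.z≤n
size-∩₁≤ (just true)  (just true)  = ℕP.≤-refl
size-∩₁≤ (just true)  (just false) = ℕ.z≤n
size-∩₁≤ (just false) (just true)  = ℕ.z≤n
size-∩₁≤ (just false) (just false) = ℕP.≤-refl

size-∩₁< : ∀ s t c → t ≡ just c → s ≢ just c → size (∩₁ s t) ℕ.< size t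
size-∩₁< nothing      _ _     refl _   = ℕP.≤-refl
size-∩₁< (just true)  _ true  refl s≢ = ⊥-elim (s≢ refl)
size-∩₁< (just true)  _ false refl _  = ℕP.≤-refl
size-∩₁< (just false) _ true  refl _  = ℕP.≤-refl
size-∩₁< (just false) _ false refl s≢ = ⊥-elim (s≢ refl)

point-or-absent : ∀ s t → ∩₁ s t ≡ nothing ⊎ ⊔₁ s t ≡ ∩₁ s t
point-or-absent nothing      _            = inj₁ refl
point-or-absent (just true)  nothing      = inj₁ refl
point-or-absent (just false) nothing      = inj₁ refl
point-or-absent (just true)  (just true)  = inj₂ refl
point-or-absent (just true)  (just false) = inj₁ refl
point-or-absent (just false) (just true)  = inj₁ refl
point-or-absent (just false) (just false) = inj₂ refl

gain : Maybe Bool → Bool → Bool → ℤ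
gain s b c = + hit s c - + hit s b

data Position (b : Bool) (s : Maybe Bool) : Set where
  absent    : s ≡ nothing → Position b s
  agrees    : s ≡ just b → Position b s
  disagrees : s ≡ just (not b) → Position b s

position : ∀ s b → Position b s
position nothing      _     = absent refl
position (just true)  true  = agrees refl
position (just true)  false = disagrees refl
position (just false) true  = disagrees refl
position (just false) false = agrees refl

gain-absent : ∀ {s} b → s ≡ nothing → gain s b (not b) ≡ + 0
gain-absent _ refl = refl

gain-agrees : ∀ {s} b → s ≡ just b → gain s b (not b) ≡ -[1+ 0 ]
gain-agrees true  refl = refl
gain-agrees false refl = refl

gain-disagrees : ∀ {s} b → s ≡ just (not b) → gain s b (not b) ≡ + 1
gain-disagrees true  refl = refl
gain-disagrees false refl = refl

gain≤1 : ∀ s b → gain s b (not b) ≤ + 1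
gain≤1 s b with position s b
... | absent    e = ℤP.≤-trans (ℤP.≤-reflexive (gain-absent b e)) (+≤+ ℕ.z≤n)
... | agrees    e = ℤP.≤-trans (ℤP.≤-reflexive (gain-agrees b e)) ℤ.-≤+
... | disagrees e = ℤP.≤-reflexive (gain-disagrees b e)

gain-values : ∀ r a b → gain r a b ≡ + 0 ⊎ gain r a b ≡ + 1 ⊎ gain r a b ≡ -[1+ 0 ]
gain-values nothing      _     _     = inj₁ refl
gain-values (just true)  true  true  = inj₁ refl
gain-values (just true)  true  false = inj₂ (inj₂ refl)
gain-values (just true)  false true  = inj₂ (inj₁ refl)
gain-values (just true)  false false = inj₁ refl
gain-values (just false) true  true  = inj₁ refl
gain-values (just false) true  false = inj₂ (inj₁ refl)
gain-values (just false) false true  = inj₂ (inj₂ refl)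
gain-values (just false) false false = inj₁ refl

card-∷ : ∀ {n} (s : Maybe Bool) (S : AdS n) → card (s ∷ S) ≡ size s ℕ.+ card S
card-∷ nothing  S = refl
card-∷ (just _) S = refl

∩-zeroˡ : ∀ {n} (S : AdS n) → ∅ ∩ S ≡ ∅
∩-zeroˡ []      = refl
∩-zeroˡ (s ∷ S) = cong (nothing ∷_) (∩-zeroˡ S)

∩-zeroʳ : ∀ {n} (S : AdS n) → S ∩ ∅ ≡ ∅
∩-zeroʳ []               = refl
∩-zeroʳ (nothing ∷ S)    = cong (nothing ∷_) (∩-zeroʳ S)
∩-zeroʳ (just true ∷ S)  = cong (nothing ∷_) (∩-zeroʳ S)
∩-zeroʳ (just false ∷ S) = cong (nothing ∷_) (∩-zeroʳ S)

⊔-identityˡ : ∀ {n} (S : AdS n) → ∅ ⊔ S ≡ S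
⊔-identityˡ []      = refl
⊔-identityˡ (s ∷ S) = cong (s ∷_) (⊔-identityˡ S)

⊔-identityʳ : ∀ {n} (S : AdS n) → S ⊔ ∅ ≡ S
⊔-identityʳ []            = refl
⊔-identityʳ (nothing ∷ S) = cong (nothing ∷_) (⊔-identityʳ S)
⊔-identityʳ (just b ∷ S)  = cong (just b ∷_) (⊔-identityʳ S)

bar-∅ : ∀ {n} → bar (∅ {n}) ≡ ∅
bar-∅ {zero}  = refl
bar-∅ {suc n} = cong (nothing ∷_) bar-∅

card-∅ : ∀ {n} → card (∅ {n}) ≡ 0
card-∅ {zero}  = refl
card-∅ {suc n} = card-∅ {n}

card-singleton : ∀ {n} b → card (just b ∷ ∅ {n}) ≡ 1
card-singleton {n} b = cong suc (card-∅ {n})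

card-bar : ∀ {n} (S : AdS n) → card (bar S) ≡ card S
card-bar []            = refl
card-bar (nothing ∷ S) = card-bar S
card-bar (just _ ∷ S)  = cong suc (card-bar S)

bar-involutive : ∀ {n} (S : AdS n) → bar (bar S) ≡ S
bar-involutive []               = refl
bar-involutive (nothing ∷ S)    = cong (nothing ∷_) (bar-involutive S)
bar-involutive (just true ∷ S)  = cong (just true ∷_) (bar-involutive S)
bar-involutive (just false ∷ S) = cong (just false ∷_) (bar-involutive S)

∩-idem : ∀ {n} (S : AdS n) → S ∩ S ≡ S
∩-idem []               = refl
∩-idem (nothing ∷ S)    = cong (nothing ∷_) (∩-idem S)
∩-idem (just true ∷ S)  = cong (just true ∷_) (∩-idem S)
∩-idem (just false ∷ S) = cong (just false ∷_) (∩-idem S)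

⊔-idem : ∀ {n} (S : AdS n) → S ⊔ S ≡ S
⊔-idem []               = refl
⊔-idem (nothing ∷ S)    = cong (nothing ∷_) (⊔-idem S)
⊔-idem (just true ∷ S)  = cong (just true ∷_) (⊔-idem S)
⊔-idem (just false ∷ S) = cong (just false ∷_) (⊔-idem S)

∩-inverseʳ : ∀ {n} (S : AdS n) → S ∩ bar S ≡ ∅
∩-inverseʳ []               = refl
∩-inverseʳ (nothing ∷ S)    = cong (nothing ∷_) (∩-inverseʳ S)
∩-inverseʳ (just true ∷ S)  = cong (nothing ∷_) (∩-inverseʳ S)
∩-inverseʳ (just false ∷ S) = cong (nothing ∷_) (∩-inverseʳ S)

⊔-inverseʳ : ∀ {n} (S : AdS n) → S ⊔ bar S ≡ ∅
⊔-inverseʳ []               = refl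
⊔-inverseʳ (nothing ∷ S)    = cong (nothing ∷_) (⊔-inverseʳ S)
⊔-inverseʳ (just true ∷ S)  = cong (nothing ∷_) (⊔-inverseʳ S)
⊔-inverseʳ (just false ∷ S) = cong (nothing ∷_) (⊔-inverseʳ S)

lookup-∩ : ∀ {n} (S T : AdS n) k → lookup (S ∩ T) k ≡ ∩₁ (lookup S k) (lookup T k)
lookup-∩ S T k = VecP.lookup-zipWith ∩₁ k S T

lookup-⊔ : ∀ {n} (S T : AdS n) k → lookup (S ⊔ T) k ≡ ⊔₁ (lookup S k) (lookup T k)
lookup-⊔ S T k = VecP.lookup-zipWith ⊔₁ k S T

card-∩-≤ : ∀ {n} (S T : AdS n) → card (S ∩ T) ℕ.≤ card T
card-∩-≤ []      []      = ℕ.z≤n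
card-∩-≤ (s ∷ S) (t ∷ T) = subst₂ ℕ._≤_ (sym (card-∷ (∩₁ s t) (S ∩ T))) (sym (card-∷ t T))
  (ℕP.+-mono-≤ (size-∩₁≤ s t) (card-∩-≤ S T))

card-∩-< : ∀ {n} (S T : AdS n) k c → lookup T k ≡ just c → lookup S k ≢ just c → card (S ∩ T) ℕ.< card T
card-∩-< (s ∷ S) (t ∷ T) k c Tₖ Sₖ =
  subst₂ ℕ._<_ (sym (card-∷ (∩₁ s t) (S ∩ T))) (sym (card-∷ t T)) (go k Tₖ Sₖ)
  where
  go : ∀ k → lookup (t ∷ T) k ≡ just c → lookup (s ∷ S) k ≢ just c →
       size (∩₁ s t) ℕ.+ card (S ∩ T) ℕ.< size t ℕ.+ card T
  go Fin.zero    tₖ sₖ = ℕP.+-mono-<-≤ (size-∩₁< s t c tₖ sₖ) (card-∩-≤ S T)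
  go (Fin.suc k) Tₖ Sₖ = ℕP.+-mono-≤-< (size-∩₁≤ s t) (card-∩-< S T k c Tₖ Sₖ)

_⊆_ : ∀ {n} → AdS n → Full n → Set
[]            ⊆ []      = ⊤
(nothing ∷ U) ⊆ (b ∷ X) = U ⊆ X
(just a ∷ U)  ⊆ (b ∷ X) = a ≡ b × U ⊆ X

⊆⇒∩-toAdS : ∀ {n} (U : AdS n) (X : Full n) → U ⊆ X → U ∩ toAdS X ≡ U
⊆⇒∩-toAdS []               []          _            = refl
⊆⇒∩-toAdS (nothing ∷ U)    (b ∷ X)     U⊆X          = cong (nothing ∷_) (⊆⇒∩-toAdS U X U⊆X)
⊆⇒∩-toAdS (just true ∷ U)  (true ∷ X)  (refl , U⊆X) = cong (just true ∷_) (⊆⇒∩-toAdS U X U⊆X)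
⊆⇒∩-toAdS (just false ∷ U) (false ∷ X) (refl , U⊆X) = cong (just false ∷_) (⊆⇒∩-toAdS U X U⊆X)

⊆⇒⊔-toAdS : ∀ {n} (U : AdS n) (X : Full n) → U ⊆ X → U ⊔ toAdS X ≡ toAdS X
⊆⇒⊔-toAdS []               []          _            = refl
⊆⇒⊔-toAdS (nothing ∷ U)    (b ∷ X)     U⊆X          = cong (just b ∷_) (⊆⇒⊔-toAdS U X U⊆X)
⊆⇒⊔-toAdS (just true ∷ U)  (true ∷ X)  (refl , U⊆X) = cong (just true ∷_) (⊆⇒⊔-toAdS U X U⊆X)
⊆⇒⊔-toAdS (just false ∷ U) (false ∷ X) (refl , U⊆X) = cong (just false ∷_) (⊆⇒⊔-toAdS U X U⊆X)

⊆⇒card-∩-bar : ∀ {n} (U : AdS n) (X : Full n) → U ⊆ X → card (U ∩ bar (toAdS X)) ≡ 0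
⊆⇒card-∩-bar []               []          _            = refl
⊆⇒card-∩-bar (nothing ∷ U)    (b ∷ X)     U⊆X          = ⊆⇒card-∩-bar U X U⊆X
⊆⇒card-∩-bar (just true ∷ U)  (true ∷ X)  (refl , U⊆X) = ⊆⇒card-∩-bar U X U⊆X
⊆⇒card-∩-bar (just false ∷ U) (false ∷ X) (refl , U⊆X) = ⊆⇒card-∩-bar U X U⊆X

∩-toAdS-⊆ : ∀ {n} (T : AdS n) (X : Full n) → (T ∩ toAdS X) ⊆ X
∩-toAdS-⊆ []               []          = tt
∩-toAdS-⊆ (nothing ∷ T)    (b ∷ X)     = ∩-toAdS-⊆ T X
∩-toAdS-⊆ (just true ∷ T)  (true ∷ X)  = refl , ∩-toAdS-⊆ T X
∩-toAdS-⊆ (just true ∷ T)  (false ∷ X) = ∩-toAdS-⊆ T X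
∩-toAdS-⊆ (just false ∷ T) (true ∷ X)  = ∩-toAdS-⊆ T X
∩-toAdS-⊆ (just false ∷ T) (false ∷ X) = refl , ∩-toAdS-⊆ T X

⊔-toAdS-⊆ : ∀ {n} (T : AdS n) (X : Full n) → (T ⊔ toAdS X) ⊆ X
⊔-toAdS-⊆ []               []          = tt
⊔-toAdS-⊆ (nothing ∷ T)    (b ∷ X)     = refl , ⊔-toAdS-⊆ T X
⊔-toAdS-⊆ (just true ∷ T)  (true ∷ X)  = refl , ⊔-toAdS-⊆ T X
⊔-toAdS-⊆ (just true ∷ T)  (false ∷ X) = ⊔-toAdS-⊆ T X
⊔-toAdS-⊆ (just false ∷ T) (true ∷ X)  = ⊔-toAdS-⊆ T X
⊔-toAdS-⊆ (just false ∷ T) (false ∷ X) = refl , ⊔-toAdS-⊆ T X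

meet : ∀ {n} → AdS n → Full n → ℕ
meet []      []      = 0
meet (s ∷ S) (b ∷ B) = hit s b ℕ.+ meet S B

card-∩-toAdS : ∀ {n} (S : AdS n) (B : Full n) → card (S ∩ toAdS B) ≡ meet S B
card-∩-toAdS []               []          = refl
card-∩-toAdS (nothing ∷ S)    (b ∷ B)     = card-∩-toAdS S B
card-∩-toAdS (just true ∷ S)  (true ∷ B)  = cong suc (card-∩-toAdS S B)
card-∩-toAdS (just true ∷ S)  (false ∷ B) = card-∩-toAdS S B
card-∩-toAdS (just false ∷ S) (true ∷ B)  = card-∩-toAdS S B
card-∩-toAdS (just false ∷ S) (false ∷ B) = cong suc (card-∩-toAdS S B)

meet-+-bar : ∀ {n} (S : AdS n) (B : Full n) → meet S B ℕ.+ meet (bar S) B ≡ card S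
meet-+-bar []      []      = refl
meet-+-bar (s ∷ S) (b ∷ B) = begin
  (hit s b ℕ.+ meet S B) ℕ.+ (hit (Maybe.map not s) b ℕ.+ meet (bar S) B)
    ≡⟨ ℕ-+.interchange (hit s b) _ _ _ ⟩
  (hit s b ℕ.+ hit (Maybe.map not s) b) ℕ.+ (meet S B ℕ.+ meet (bar S) B)
    ≡⟨ cong₂ ℕ._+_ (hit-+-bar s b) (meet-+-bar S B) ⟩
  size s ℕ.+ card S
    ≡⟨ card-∷ s S ⟨
  card (s ∷ S) ∎
  where open ≡-Reasoning

meet≤card : ∀ {n} (S : AdS n) (B : Full n) → meet S B ℕ.≤ card S
meet≤card S B = subst (meet S B ℕ.≤_) (meet-+-bar S B) (ℕP.m≤m+n _ _)

meet-∅ : ∀ {n} (B : Full n) → meet ∅ B ≡ 0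
meet-∅ []      = refl
meet-∅ (b ∷ B) = meet-∅ B

meet-modular : ∀ {n} (S T : AdS n) (B : Full n) →
  meet (S ∩ T) B ℕ.+ meet (S ⊔ T) B ℕ.+ card (S ∩ bar T) ≡ meet S B ℕ.+ meet T B
meet-modular []      []      []      = refl
meet-modular (s ∷ S) (t ∷ T) (b ∷ B) = begin
  (hit u b ℕ.+ meet (S ∩ T) B) ℕ.+ (hit w b ℕ.+ meet (S ⊔ T) B) ℕ.+ card (c ∷ (S ∩ bar T))
    ≡⟨ cong ((hit u b ℕ.+ meet (S ∩ T) B) ℕ.+ (hit w b ℕ.+ meet (S ⊔ T) B) ℕ.+_) (card-∷ c (S ∩ bar T)) ⟩
  (hit u b ℕ.+ meet (S ∩ T) B) ℕ.+ (hit w b ℕ.+ meet (S ⊔ T) B) ℕ.+ (size c ℕ.+ card (S ∩ bar T))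
    ≡⟨ regroup (hit u b) (hit w b) (size c) _ _ _ ⟩
  (hit u b ℕ.+ hit w b ℕ.+ size c) ℕ.+ (meet (S ∩ T) B ℕ.+ meet (S ⊔ T) B ℕ.+ card (S ∩ bar T))
    ≡⟨ cong₂ ℕ._+_ (hit-modular s t b) (meet-modular S T B) ⟩
  (hit s b ℕ.+ hit t b) ℕ.+ (meet S B ℕ.+ meet T B)
    ≡⟨ ℕ-+.interchange (hit s b) _ _ _ ⟩
  (hit s b ℕ.+ meet S B) ℕ.+ (hit t b ℕ.+ meet T B) ∎
  where
  open ≡-Reasoning
  u = ∩₁ s t
  w = ⊔₁ s t
  c = ∩₁ s (Maybe.map not t)
  regroup : ∀ a b c A B C → (a ℕ.+ A) ℕ.+ (b ℕ.+ B) ℕ.+ (c ℕ.+ C) ≡ (a ℕ.+ b ℕ.+ c) ℕ.+ (A ℕ.+ B ℕ.+ C)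
  regroup = ℕ-Solver.solve-∀

meet-update : ∀ {n} (T : AdS n) (B : Full n) k c →
  + meet T (B [ k ]≔ c) ≡ + meet T B + gain (lookup T k) (lookup B k) c
meet-update (t ∷ T) (b ∷ B) Fin.zero c = begin
  + (hit t c ℕ.+ meet T B)                      ≡⟨ ℤP.pos-+ (hit t c) (meet T B) ⟩
  + hit t c + + meet T B                        ≡⟨ regroup (+ hit t c) (+ hit t b) (+ meet T B) ⟩
  + hit t b + + meet T B + gain t b c           ≡⟨ cong (_+ gain t b c) (ℤP.pos-+ (hit t b) (meet T B)) ⟨
  + (hit t b ℕ.+ meet T B) + gain t b c         ∎
  where
  open ≡-Reasoning
  regroup : ∀ c b m → c + m ≡ b + m + (c - b)
  regroup = solve-∀
meet-update (t ∷ T) (b ∷ B) (Fin.suc k) c = begin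
  + (hit t b ℕ.+ meet T (B [ k ]≔ c))           ≡⟨ ℤP.pos-+ (hit t b) (meet T (B [ k ]≔ c)) ⟩
  + hit t b + + meet T (B [ k ]≔ c)             ≡⟨ cong (ℤ._+_ (+ hit t b)) (meet-update T B k c) ⟩
  + hit t b + (+ meet T B + g)                  ≡⟨ ℤP.+-assoc (+ hit t b) (+ meet T B) g ⟨
  + hit t b + + meet T B + g                    ≡⟨ cong (_+ g) (ℤP.pos-+ (hit t b) (meet T B)) ⟨
  + (hit t b ℕ.+ meet T B) + g                  ∎
  where
  open ≡-Reasoning
  g = gain (lookup T k) (lookup B k) c

meet-mono : ∀ {n} (T : AdS n) (B B' : Full n) →
  (∀ k → hit (lookup T k) (lookup B k) ℕ.≤ hit (lookup T k) (lookup B' k)) → meet T B ℕ.≤ meet T B'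
meet-mono []      []      []        _  = ℕ.z≤n
meet-mono (t ∷ T) (b ∷ B) (b' ∷ B') ≤ₖ =
  ℕP.+-mono-≤ (≤ₖ Fin.zero) (meet-mono T B B' (λ k → ≤ₖ (Fin.suc k)))

meet-mono-< : ∀ {n} (T : AdS n) (B B' : Full n) →
  (∀ k → hit (lookup T k) (lookup B k) ℕ.≤ hit (lookup T k) (lookup B' k)) →
  ∀ i → hit (lookup T i) (lookup B i) ℕ.< hit (lookup T i) (lookup B' i) → meet T B ℕ.< meet T B'
meet-mono-< (t ∷ T) (b ∷ B) (b' ∷ B') ≤ₖ Fin.zero    <ᵢ =
  ℕP.+-mono-<-≤ <ᵢ (meet-mono T B B' (λ k → ≤ₖ (Fin.suc k)))
meet-mono-< (t ∷ T) (b ∷ B) (b' ∷ B') ≤ₖ (Fin.suc i) <ᵢ =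
  ℕP.+-mono-≤-< (≤ₖ Fin.zero) (meet-mono-< T B B' (λ k → ≤ₖ (Fin.suc k)) i <ᵢ)

-- h-values are maximal overlaps

pairing-+-card : ∀ {n} (S : AdS n) (B : Full n) → pairing S B + + card S ≡ + 2 * + meet S B
pairing-+-card S B = begin
  + card (S ∩ toAdS B) - + card (bar S ∩ toAdS B) + + card S
    ≡⟨ cong₂ (λ a b → + a - + b + + card S) (card-∩-toAdS S B) (card-∩-toAdS (bar S) B) ⟩
  + m - + m̄ + + card S
    ≡⟨ cong (λ k → + m - + m̄ + + k) (meet-+-bar S B) ⟨
  + m - + m̄ + + (m ℕ.+ m̄)
    ≡⟨ cong (ℤ._+_ (+ m - + m̄)) (ℤP.pos-+ m m̄) ⟩
  + m - + m̄ + (+ m + + m̄)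
    ≡⟨ cancel (+ m) (+ m̄) ⟩
  + 2 * + m ∎
  where
  open ≡-Reasoning
  m = meet S B
  m̄ = meet (bar S) B
  cancel : ∀ a b → a - b + (a + b) ≡ + 2 * a
  cancel = solve-∀

MaxMeet : ∀ {n} → (Full n → Bool) → AdS n → ℤ → Set
MaxMeet F S v = (∃ λ B → Feasible F B × + meet S B ≡ v) × (∀ B → Feasible F B → + meet S B ≤ v)

hValue⇒maxMeet : ∀ {n} (F : Full n → Bool) S v → IsHValue F S v → MaxMeet F S v
hValue⇒maxMeet F S v (g , ((B₀ , B₀∈F , B₀-attains) , g-bound) , 2v≡g+|S|) =
  (B₀ , B₀∈F , ℤP.*-cancelˡ-≡ (+ 2) _ _ 2meet≡2v) ,
  λ B B∈F → ℤP.*-cancelˡ-≤-pos _ _ (+ 2) (2meet≤2v B B∈F)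
  where
  open ℤP.≤-Reasoning
  2meet≡2v : + 2 * + meet S B₀ ≡ + 2 * v
  2meet≡2v = trans (sym (pairing-+-card S B₀)) (trans (cong (_+ + card S) B₀-attains) (sym 2v≡g+|S|))
  2meet≤2v : ∀ B → Feasible F B → + 2 * + meet S B ≤ + 2 * v
  2meet≤2v B B∈F = begin
    + 2 * + meet S B     ≡⟨ pairing-+-card S B ⟨
    pairing S B + + card S ≤⟨ ℤP.+-monoˡ-≤ (+ card S) (g-bound B B∈F) ⟩
    g + + card S         ≡⟨ 2v≡g+|S| ⟨
    + 2 * v              ∎

maxMeet⇒hValue : ∀ {n} (F : Full n → Bool) S v → MaxMeet F S v → IsHValue F S v
maxMeet⇒hValue F S v ((B₀ , B₀∈F , meet≡v) , meet≤v) =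
  pairing S B₀ , ((B₀ , B₀∈F , refl) , pairing≤) , 2v≡
  where
  pairing≡ : ∀ B → pairing S B ≡ + 2 * + meet S B - + card S
  pairing≡ B = trans (sym (i+j-j≡i (pairing S B) (+ card S))) (cong (_- + card S) (pairing-+-card S B))
  pairing≤ : ∀ B → Feasible F B → pairing S B ≤ pairing S B₀
  pairing≤ B B∈F = subst₂ _≤_ (sym (pairing≡ B)) (sym (pairing≡ B₀))
    (ℤP.+-monoˡ-≤ (- + card S)
      (ℤP.*-monoˡ-≤-nonNeg (+ 2) (ℤP.≤-trans (meet≤v B B∈F) (ℤP.≤-reflexive (sym meet≡v)))))
  2v≡ : + 2 * v ≡ pairing S B₀ + + card S
  2v≡ = trans (cong (+ 2 *_) (sym meet≡v)) (sym (pairing-+-card S B₀))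

-- From the axioms to bases: the greedy construction

HAxioms : ∀ {n} → (AdS n → ℤ) → Set
HAxioms h = (h ∅ ≡ + 0) × (∀ S → card S ≡ 1 → h S ≡ + 0 ⊎ h S ≡ + 1) ×
  (∀ S T → h (S ∩ T) + h (S ⊔ T) + + card (S ∩ bar T) ≤ h S + h T)

module _ {n} {h : AdS n → ℤ} (ax : HAxioms h) where

  h-∅ : h ∅ ≡ + 0
  h-∅ = proj₁ ax

  h-singleton≤1 : ∀ S → card S ≡ 1 → h S ≤ + 1
  h-singleton≤1 S |S|≡1 with proj₁ (proj₂ ax) S |S|≡1
  ... | inj₁ h≡0 = ℤP.≤-trans (ℤP.≤-reflexive h≡0) (+≤+ ℕ.z≤n)
  ... | inj₂ h≡1 = ℤP.≤-reflexive h≡1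

  submodular-at : ∀ S T {A C c} → S ∩ T ≡ A → S ⊔ T ≡ C → card (S ∩ bar T) ≡ c →
    h A + h C + + c ≤ h S + h T
  submodular-at S T refl refl refl = proj₂ (proj₂ ax) S T

  subadditive-at : ∀ S T {C} → S ∩ T ≡ ∅ → S ⊔ T ≡ C → card (S ∩ bar T) ≡ 0 → h C ≤ h S + h T
  subadditive-at S T {C} ∩≡∅ ⊔≡C |S∩T̄|≡0 = begin
    h C              ≡⟨ 0+i+0≡i (h C) ⟨
    + 0 + h C + + 0  ≡⟨ cong (λ z → z + h C + + 0) h-∅ ⟨
    h ∅ + h C + + 0  ≤⟨ submodular-at S T ∩≡∅ ⊔≡C |S∩T̄|≡0 ⟩
    h S + h T        ∎
    where open ℤP.≤-Reasoning

restrict : ∀ {n} → (AdS (suc n) → ℤ) → AdS n → ℤ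
restrict h T = h (nothing ∷ T)

contract : ∀ {n} → Bool → (AdS (suc n) → ℤ) → AdS n → ℤ
contract b h T = h (just b ∷ T) - h (just b ∷ ∅)

module _ {n} {h : AdS (suc n) → ℤ} (ax : HAxioms h) where

  split-≤ : ∀ b (Y : AdS n) → h (just b ∷ Y) ≤ h (nothing ∷ Y) + h (just b ∷ ∅)
  split-≤ b Y = subadditive-at ax (nothing ∷ Y) (just b ∷ ∅)
    (cong (nothing ∷_) (∩-zeroʳ Y)) (cong (just b ∷_) (⊔-identityʳ Y))
    (trans (cong (λ Z → card (Y ∩ Z)) bar-∅) (trans (cong card (∩-zeroʳ Y)) (card-∅ {n})))

  step≤1 : ∀ b (Y : AdS n) → h (just b ∷ Y) ≤ h (nothing ∷ Y) + + 1
  step≤1 b Y = ℤP.≤-trans (split-≤ b Y)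
    (ℤP.+-monoʳ-≤ (h (nothing ∷ Y)) (h-singleton≤1 ax (just b ∷ ∅) (card-singleton {n} b)))

  step-mono : ∀ b (Y : AdS n) → h (nothing ∷ Y) ≤ h (just b ∷ Y)
  step-mono b Y = i+i+1≤j+k→k≤i+1⇒i≤j
    (submodular-at ax (just b ∷ Y) (just (not b) ∷ Y)
      (cong₂ _∷_ (∩₁-inverseʳ b) (∩-idem Y)) (cong₂ _∷_ (⊔₁-inverseʳ b) (⊔-idem Y))
      (trans (cong₂ (λ s Z → card (s ∷ Z)) (∩₁-bar-bar b) (∩-inverseʳ Y)) (card-singleton {n} b)))
    (step≤1 (not b) Y)
    where
    ∩₁-bar-bar : ∀ b → ∩₁ (just b) (just (not (not b))) ≡ just b
    ∩₁-bar-bar true  = refl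
    ∩₁-bar-bar false = refl

  singleton-step≤1 : ∀ b (e : AdS n) → card e ≡ 1 → h (just b ∷ e) ≤ h (just b ∷ ∅) + + 1
  singleton-step≤1 b e |e|≡1 = ℤP.≤-trans
    (subadditive-at ax (just b ∷ ∅) (nothing ∷ e)
      (cong₂ _∷_ (∩₁-zeroʳ (just b)) (∩-zeroˡ e)) (cong₂ _∷_ (⊔₁-identityʳ (just b)) (⊔-identityˡ e))
      (trans (cong₂ (λ s Z → card (s ∷ Z)) (∩₁-zeroʳ (just b)) (∩-zeroˡ (bar e))) (card-∅ {n})))
    (ℤP.+-monoʳ-≤ (h (just b ∷ ∅)) (h-singleton≤1 ax (nothing ∷ e) |e|≡1))

  singleton-step-mono : ∀ b (e : AdS n) → card e ≡ 1 → h (just b ∷ ∅) ≤ h (just b ∷ e)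
  singleton-step-mono b e |e|≡1 = i+i+1≤j+k→k≤i+1⇒i≤j
    (submodular-at ax (just b ∷ e) (just b ∷ bar e)
      (cong₂ _∷_ (∩₁-idem (just b)) (∩-inverseʳ e)) (cong₂ _∷_ (⊔₁-idem (just b)) (⊔-inverseʳ e))
      (trans (cong₂ (λ s Z → card (s ∷ Z)) (∩₁-inverseʳ b) (trans (cong (e ∩_) (bar-involutive e)) (∩-idem e)))
             |e|≡1))
    (singleton-step≤1 b (bar e) (trans (card-bar e) |e|≡1))

  restrict-axioms : HAxioms (restrict h)
  restrict-axioms = h-∅ ax , (λ S → proj₁ (proj₂ ax) (nothing ∷ S))
                  , (λ S T → proj₂ (proj₂ ax) (nothing ∷ S) (nothing ∷ T))

  contract-axioms : ∀ b → HAxioms (contract b h)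
  contract-axioms b = ℤP.+-inverseʳ (h (just b ∷ ∅)) , singleton , submodular
    where
    singleton : ∀ S → card S ≡ 1 → contract b h S ≡ + 0 ⊎ contract b h S ≡ + 1
    singleton S |S|≡1 = i≤j≤i+1⇒j-i∈01 (singleton-step-mono b S |S|≡1) (singleton-step≤1 b S |S|≡1)
    shift : ∀ k a c d s t → a + c + d ≤ s + t → (a - k) + (c - k) + d ≤ (s - k) + (t - k)
    shift k a c d s t le = subst₂ _≤_ (regroup a c d k) (regroup₂ s t k) (ℤP.+-monoˡ-≤ (- (k + k)) le)
      where
      regroup : ∀ a c d k → a + c + d - (k + k) ≡ (a - k) + (c - k) + d
      regroup = solve-∀
      regroup₂ : ∀ s t k → s + t - (k + k) ≡ (s - k) + (t - k)
      regroup₂ = solve-∀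
    submodular : ∀ S T → contract b h (S ∩ T) + contract b h (S ⊔ T) + + card (S ∩ bar T)
                         ≤ contract b h S + contract b h T
    submodular S T =
      shift (h (just b ∷ ∅)) (h (just b ∷ (S ∩ T))) (h (just b ∷ (S ⊔ T))) (+ card (S ∩ bar T))
            (h (just b ∷ S)) (h (just b ∷ T))
        (submodular-at ax (just b ∷ S) (just b ∷ T)
          (cong (_∷ (S ∩ T)) (∩₁-idem (just b))) (cong (_∷ (S ⊔ T)) (⊔₁-idem (just b)))
          (cong (λ s → card (s ∷ (S ∩ bar T))) (∩₁-inverseʳ b)))

Below : ∀ {n} → (AdS n → ℤ) → Full n → Set
Below h B = ∀ T → + meet T B ≤ h T

-- A basis that is tight on a full set X and respects h on the subsets of X respects h everywhere
-- (framed⇒below); this is the invariant the greedy construction carries through the minors.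
record FramedBasis {n} (h : AdS n → ℤ) (S : AdS n) : Set where
  field
    basis frame    : Full n
    frame-tight    : + meet (toAdS frame) basis ≡ h (toAdS frame)
    below-on-frame : ∀ U → U ⊆ frame → + meet U basis ≤ h U
    S-tight        : + meet S basis ≡ h S

choose-hit : ∀ c {d} → d ≡ + 0 ⊎ d ≡ + 1 → ∃ λ x → + hit (just c) x ≡ d
choose-hit true  (inj₁ refl) = false , refl
choose-hit false (inj₁ refl) = true  , refl
choose-hit true  (inj₂ refl) = true  , refl
choose-hit false (inj₂ refl) = false , refl

greedy : ∀ {n} {h : AdS n → ℤ} → HAxioms h → ∀ S → FramedBasis h S
greedy {zero} ax [] = record
  { basis = [] ; frame = [] ; frame-tight = sym (h-∅ ax)
  ; below-on-frame = λ { [] _ → ℤP.≤-reflexive (sym (h-∅ ax)) } ; S-tight = sym (h-∅ ax) }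
greedy {suc n} {h} ax (just b ∷ S₀) = record
  { basis = x₀ ∷ basis ; frame = b ∷ frame ; frame-tight = extend frame-tight
  ; below-on-frame = below ; S-tight = extend S-tight }
  where
  open FramedBasis (greedy (contract-axioms ax b) S₀)
  open ℤP.≤-Reasoning
  k = h (just b ∷ ∅)
  x₀ = proj₁ (choose-hit b (proj₁ (proj₂ ax) (just b ∷ ∅) (card-singleton {n} b)))
  hit≡k : + hit (just b) x₀ ≡ k
  hit≡k = proj₂ (choose-hit b (proj₁ (proj₂ ax) (just b ∷ ∅) (card-singleton {n} b)))
  extend : ∀ {U} → + meet U basis ≡ contract b h U → + meet (just b ∷ U) (x₀ ∷ basis) ≡ h (just b ∷ U)
  extend {U} tight = begin-equality
    + (hit (just b) x₀ ℕ.+ meet U basis) ≡⟨ ℤP.pos-+ (hit (just b) x₀) (meet U basis) ⟩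
    + hit (just b) x₀ + + meet U basis   ≡⟨ cong₂ _+_ hit≡k tight ⟩
    k + (h (just b ∷ U) - k)             ≡⟨ i+[j-i]≡j k (h (just b ∷ U)) ⟩
    h (just b ∷ U)                       ∎
  below : ∀ U → U ⊆ (b ∷ frame) → + meet U (x₀ ∷ basis) ≤ h U
  below (nothing ∷ U) U⊆ = ℤP.≤-trans (below-on-frame U U⊆) (i≤j+k⇒i-k≤j (split-≤ ax b U))
  below (just _ ∷ U) (refl , U⊆) = begin
    + (hit (just b) x₀ ℕ.+ meet U basis) ≡⟨ ℤP.pos-+ (hit (just b) x₀) (meet U basis) ⟩
    + hit (just b) x₀ + + meet U basis   ≤⟨ ℤP.+-mono-≤ (ℤP.≤-reflexive hit≡k) (below-on-frame U U⊆) ⟩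
    k + (h (just b ∷ U) - k)             ≡⟨ i+[j-i]≡j k (h (just b ∷ U)) ⟩
    h (just b ∷ U)                       ∎
greedy {suc n} {h} ax (nothing ∷ S₀) = record
  { basis = x₀ ∷ basis ; frame = true ∷ frame ; frame-tight = frame-tight′
  ; below-on-frame = below ; S-tight = S-tight }
  where
  open FramedBasis (greedy (restrict-axioms ax) S₀)
  open ℤP.≤-Reasoning
  X = toAdS frame
  jump = i≤j≤i+1⇒j-i∈01 (step-mono ax true X) (step≤1 ax true X)
  x₀ = proj₁ (choose-hit true jump)
  hit≡jump : + hit (just true) x₀ ≡ h (just true ∷ X) - h (nothing ∷ X)
  hit≡jump = proj₂ (choose-hit true jump)
  frame-tight′ : + meet (just true ∷ X) (x₀ ∷ basis) ≡ h (just true ∷ X)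
  frame-tight′ = begin-equality
    + (hit (just true) x₀ ℕ.+ meet X basis)
      ≡⟨ ℤP.pos-+ (hit (just true) x₀) (meet X basis) ⟩
    + hit (just true) x₀ + + meet X basis
      ≡⟨ cong₂ _+_ hit≡jump frame-tight ⟩
    h (just true ∷ X) - h (nothing ∷ X) + h (nothing ∷ X)
      ≡⟨ i-j+j≡i (h (just true ∷ X)) (h (nothing ∷ X)) ⟩
    h (just true ∷ X) ∎
  below : ∀ U → U ⊆ (true ∷ frame) → + meet U (x₀ ∷ basis) ≤ h U
  below (nothing ∷ U) U⊆ = below-on-frame U U⊆
  below (just _ ∷ U) (refl , U⊆) = begin
    + (hit (just true) x₀ ℕ.+ meet U basis)
      ≡⟨ ℤP.pos-+ (hit (just true) x₀) (meet U basis) ⟩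
    + hit (just true) x₀ + + meet U basis
      ≤⟨ ℤP.+-mono-≤ (ℤP.≤-reflexive hit≡jump) (below-on-frame U U⊆) ⟩
    h (just true ∷ X) - h (nothing ∷ X) + h (nothing ∷ U)
      ≡⟨ regroup (h (nothing ∷ U)) (h (just true ∷ X)) (h (nothing ∷ X)) ⟩
    h (nothing ∷ U) + h (just true ∷ X) + + 0 - h (nothing ∷ X)
      ≤⟨ ℤP.+-monoˡ-≤ (- h (nothing ∷ X)) (submodular-at ax (just true ∷ U) (nothing ∷ X)
           (cong (nothing ∷_) (⊆⇒∩-toAdS U frame U⊆)) (cong (just true ∷_) (⊆⇒⊔-toAdS U frame U⊆))
           (⊆⇒card-∩-bar U frame U⊆)) ⟩
    h (just true ∷ U) + h (nothing ∷ X) - h (nothing ∷ X)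
      ≡⟨ i+j-j≡i (h (just true ∷ U)) (h (nothing ∷ X)) ⟩
    h (just true ∷ U) ∎
    where
    regroup : ∀ a c e → c - e + a ≡ a + c + + 0 - e
    regroup = solve-∀

framed⇒below : ∀ {n} {h : AdS n → ℤ} → HAxioms h → ∀ {S} (G : FramedBasis h S) →
  Below h (FramedBasis.basis G)
framed⇒below {h = h} ax G T = +-cancelʳ-≤ (+ meet X x) (begin
  + meet T x + + meet X x
    ≡⟨ ℤP.pos-+ (meet T x) (meet X x) ⟨
  + (meet T x ℕ.+ meet X x)
    ≡⟨ cong +_ (meet-modular T X x) ⟨
  + (meet (T ∩ X) x ℕ.+ meet (T ⊔ X) x ℕ.+ card (T ∩ bar X))
    ≡⟨ pos-+₃ (meet (T ∩ X) x) (meet (T ⊔ X) x) (card (T ∩ bar X)) ⟩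
  + meet (T ∩ X) x + + meet (T ⊔ X) x + + card (T ∩ bar X)
    ≤⟨ ℤP.+-monoˡ-≤ (+ card (T ∩ bar X)) (ℤP.+-mono-≤ (below-on-frame (T ∩ X) (∩-toAdS-⊆ T frame))
                                                        (below-on-frame (T ⊔ X) (⊔-toAdS-⊆ T frame))) ⟩
  h (T ∩ X) + h (T ⊔ X) + + card (T ∩ bar X)
    ≤⟨ proj₂ (proj₂ ax) T X ⟩
  h T + h X
    ≡⟨ cong (ℤ._+_ (h T)) frame-tight ⟨
  h T + + meet X x ∎)
  where
  open FramedBasis G renaming (basis to x)
  open ℤP.≤-Reasoning
  X = toAdS frame

tight-below : ∀ {n} {h : AdS n → ℤ} → HAxioms h → ∀ S → ∃ λ B → Below h B × + meet S B ≡ h S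
tight-below ax S = basis , framed⇒below ax G , S-tight
  where
  G = greedy ax S
  open FramedBasis G

-- If flipping the i-th coordinate of B towards B' violates h, every violated set is tight and contains the
-- flipped element; a smallest such set T₀ contains an element of B missing from B', at some j, and
-- flipping j as well repairs every violation.
module Exchange {n} {h : AdS n → ℤ} (ax : HAxioms h) {B : Full n} (B-below : Below h B) where

  slack : AdS n → ℤ
  slack T = h T - + meet T B

  0≤slack : ∀ T → + 0 ≤ slack T
  0≤slack T = ℤP.i≤j⇒0≤j-i (B-below T)

  Tight : AdS n → Set
  Tight T = slack T ≡ + 0

  slack-submodular : ∀ T₁ T₂ → slack (T₁ ∩ T₂) + slack (T₁ ⊔ T₂) ≤ slack T₁ + slack T₂
  slack-submodular T₁ T₂ =
    subst₂ _≤_ (regroupˡ hᵢ hᵤ c mᵢ mᵤ) (trans (cong (λ m → h₁ + h₂ - m) modular) (regroupʳ h₁ h₂ m₁ m₂))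
    (ℤP.+-monoˡ-≤ (- (mᵢ + mᵤ + c)) (proj₂ (proj₂ ax) T₁ T₂))
    where
    hᵢ = h (T₁ ∩ T₂) ; hᵤ = h (T₁ ⊔ T₂) ; h₁ = h T₁ ; h₂ = h T₂
    mᵢ = + meet (T₁ ∩ T₂) B ; mᵤ = + meet (T₁ ⊔ T₂) B ; m₁ = + meet T₁ B ; m₂ = + meet T₂ B
    c = + card (T₁ ∩ bar T₂)
    modular : mᵢ + mᵤ + c ≡ m₁ + m₂
    modular = trans (sym (pos-+₃ (meet (T₁ ∩ T₂) B) (meet (T₁ ⊔ T₂) B) (card (T₁ ∩ bar T₂))))
                    (trans (cong +_ (meet-modular T₁ T₂ B)) (ℤP.pos-+ (meet T₁ B) (meet T₂ B)))
    regroupˡ : ∀ hᵢ hᵤ c mᵢ mᵤ → hᵢ + hᵤ + c - (mᵢ + mᵤ + c) ≡ (hᵢ - mᵢ) + (hᵤ - mᵤ)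
    regroupˡ = solve-∀
    regroupʳ : ∀ h₁ h₂ m₁ m₂ → h₁ + h₂ - (m₁ + m₂) ≡ (h₁ - m₁) + (h₂ - m₂)
    regroupʳ = solve-∀

  tight⇒h≡meet : ∀ {T} → Tight T → h T ≡ + meet T B
  tight⇒h≡meet {T} = ℤP.i-j≡0⇒i≡j (h T) (+ meet T B)

  tight-∩-⊔ : ∀ {T₁ T₂} → Tight T₁ → Tight T₂ → Tight (T₁ ∩ T₂) × Tight (T₁ ⊔ T₂)
  tight-∩-⊔ {T₁} {T₂} t₁ t₂ = 0≤i→0≤j→i+j≤0⇒i≡0∧j≡0 (0≤slack (T₁ ∩ T₂)) (0≤slack (T₁ ⊔ T₂))
    (subst (slack (T₁ ∩ T₂) + slack (T₁ ⊔ T₂) ≤_) (cong₂ _+_ t₁ t₂) (slack-submodular T₁ T₂))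

  violation-slack : ∀ {T C} → ¬ (+ meet T C ≤ h T) → slack T < + meet T C - + meet T B
  violation-slack {T} {C} v = ℤP.+-monoˡ-< (- + meet T B) (ℤP.≰⇒> v)

  module _ {B' : Full n} (B'-below : Below h B') {i : Fin n} (Bᵢ≢B'ᵢ : lookup B i ≢ lookup B' i) where

    private
      bᵢ = lookup B i
      B'ᵢ≡¬bᵢ : lookup B' i ≡ not bᵢ
      B'ᵢ≡¬bᵢ = BoolP.¬-not (≢-sym Bᵢ≢B'ᵢ)
      C₀ = B [ i ]≔ lookup B' i

    ThroughFlip : AdS n → Set
    ThroughFlip T = Tight T × lookup T i ≡ just (not bᵢ)

    through-flip? : Decidable ThroughFlip
    through-flip? T = (slack T ℤ.≟ + 0) ×-dec MaybeP.≡-dec BoolP._≟_ (lookup T i) (just (not bᵢ))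

    meet-C₀ : ∀ T → + meet T C₀ - + meet T B ≡ gain (lookup T i) bᵢ (not bᵢ)
    meet-C₀ T = trans (cong (_- + meet T B) (meet-update T B i (lookup B' i)))
                      (trans (i+j-i≡j (+ meet T B) _) (cong (gain (lookup T i) bᵢ) B'ᵢ≡¬bᵢ))

    violated-C₀⇒through-flip : ∀ T → ¬ (+ meet T C₀ ≤ h T) → ThroughFlip T
    violated-C₀⇒through-flip T v = go (position (lookup T i) bᵢ)
      where
      slack<gain : slack T < gain (lookup T i) bᵢ (not bᵢ)
      slack<gain = subst (slack T <_) (meet-C₀ T) (violation-slack v)
      go : Position bᵢ (lookup T i) → ThroughFlip T
      go (absent e)    = ⊥-elim (0≤i<j≤0⇒⊥ (0≤slack T) slack<gain (ℤP.≤-reflexive (gain-absent bᵢ e)))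
      go (agrees e)    = ⊥-elim (0≤i<j≤0⇒⊥ (0≤slack T) slack<gain
                                   (ℤP.≤-trans (ℤP.≤-reflexive (gain-agrees bᵢ e)) ℤ.-≤+))
      go (disagrees e) = 0≤i<1⇒i≡0 (0≤slack T) (subst (slack T <_) (gain-disagrees bᵢ e) slack<gain) , e

    module Smallest (T₀ : AdS n) (T₀-tight : Tight T₀) (T₀ᵢ : lookup T₀ i ≡ just (not bᵢ))
                    (T₀-smallest : ∀ T → ThroughFlip T → card T₀ ℕ.≤ card T) where

      witness : ∃ λ j → lookup T₀ j ≡ just (lookup B j) × lookup B j ≢ lookup B' j
      witness with FinP.any? (λ j → MaybeP.≡-dec BoolP._≟_ (lookup T₀ j) (just (lookup B j))
                                     ×-dec ¬? (lookup B j BoolP.≟ lookup B' j))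
      ... | yes w  = w
      ... | no ¬w = ⊥-elim (ℕP.<⇒≱ meet-B<meet-B' (ℤP.drop‿+≤+ meet-B'≤meet-B))
        where
        hit≤ : ∀ k → hit (lookup T₀ k) (lookup B k) ℕ.≤ hit (lookup T₀ k) (lookup B' k)
        hit≤ k with lookup B k BoolP.≟ lookup B' k | MaybeP.≡-dec BoolP._≟_ (lookup T₀ k) (just (lookup B k))
        ... | yes Bₖ≡B'ₖ | _     = ℕP.≤-reflexive (cong (hit (lookup T₀ k)) Bₖ≡B'ₖ)
        ... | no Bₖ≢B'ₖ  | yes e = ⊥-elim (¬w (k , e , Bₖ≢B'ₖ))
        ... | no _       | no ne = subst (ℕ._≤ _) (sym (hit-other _ _ ne)) ℕ.z≤n
        hit<ᵢ : hit (lookup T₀ i) bᵢ ℕ.< hit (lookup T₀ i) (lookup B' i)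
        hit<ᵢ = subst₂ ℕ._<_
                  (sym (hit-other _ bᵢ (λ e → BoolP.not-¬ refl (sym (MaybeP.just-injective (trans (sym T₀ᵢ) e))))))
                             (sym (trans (cong₂ hit T₀ᵢ B'ᵢ≡¬bᵢ) (hit-self (not bᵢ))))
                             (ℕ.s≤s ℕ.z≤n)
        meet-B<meet-B' : meet T₀ B ℕ.< meet T₀ B'
        meet-B<meet-B' = meet-mono-< T₀ B B' hit≤ i hit<ᵢ
        meet-B'≤meet-B : + meet T₀ B' ≤ + meet T₀ B
        meet-B'≤meet-B = ℤP.≤-trans (B'-below T₀) (ℤP.≤-reflexive (tight⇒h≡meet T₀-tight))

      module _ {j : Fin n} (T₀ⱼ : lookup T₀ j ≡ just (lookup B j)) (Bⱼ≢B'ⱼ : lookup B j ≢ lookup B' j) where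

        private
          bⱼ = lookup B j
          B'ⱼ≡¬bⱼ : lookup B' j ≡ not bⱼ
          B'ⱼ≡¬bⱼ = BoolP.¬-not (≢-sym Bⱼ≢B'ⱼ)

        j≢i : j ≢ i
        j≢i refl = BoolP.not-¬ refl (MaybeP.just-injective (trans (sym T₀ⱼ) T₀ᵢ))

        through-flip⇒agrees-at-j : ∀ T → ThroughFlip T → lookup T j ≡ just bⱼ
        through-flip⇒agrees-at-j T (T-tight , Tᵢ) with MaybeP.≡-dec BoolP._≟_ (lookup T j) (just bⱼ)
        ... | yes Tⱼ = Tⱼ
        ... | no Tⱼ≢ = ⊥-elim (ℕP.<⇒≱ (card-∩-< T T₀ j bⱼ T₀ⱼ Tⱼ≢)
                         (T₀-smallest (T ∩ T₀) (proj₁ (tight-∩-⊔ T-tight T₀-tight) ,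
                                                trans (lookup-∩ T T₀ i) (trans (cong₂ ∩₁ Tᵢ T₀ᵢ) (∩₁-idem _)))))

        not-tight : ∀ T → lookup T i ≡ just (not bᵢ) → lookup T j ≡ nothing → ¬ Tight T
        not-tight T Tᵢ Tⱼ T-tight with trans (sym Tⱼ) (through-flip⇒agrees-at-j T (T-tight , Tᵢ))
        ... | ()

        C = C₀ [ j ]≔ lookup B' j

        meet-C : ∀ T → + meet T C - + meet T B ≡ gain (lookup T i) bᵢ (not bᵢ) + gain (lookup T j) bⱼ (not bⱼ)
        meet-C T = begin
          + meet T C - + meet T B
            ≡⟨ cong (_- + meet T B) (meet-update T C₀ j (lookup B' j)) ⟩
          + meet T C₀ + gain (lookup T j) (lookup C₀ j) (lookup B' j) - + meet T B
            ≡⟨ cong₂ (λ c c' → + meet T C₀ + gain (lookup T j) c c' - + meet T B)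
                     (VecP.lookup∘update′ j≢i B (lookup B' i)) B'ⱼ≡¬bⱼ ⟩
          + meet T C₀ + gⱼ - + meet T B
            ≡⟨ regroup (+ meet T C₀) gⱼ (+ meet T B) ⟩
          (+ meet T C₀ - + meet T B) + gⱼ
            ≡⟨ cong (_+ gⱼ) (meet-C₀ T) ⟩
          gain (lookup T i) bᵢ (not bᵢ) + gⱼ ∎
          where
          open ≡-Reasoning
          gⱼ = gain (lookup T j) bⱼ (not bⱼ)
          regroup : ∀ c g b → c + g - b ≡ c - b + g
          regroup = solve-∀

        both-flipped⇒2≤slack : ∀ T → lookup T i ≡ just (not bᵢ) → lookup T j ≡ just (not bⱼ) → + 2 ≤ slack T
        both-flipped⇒2≤slack T Tᵢ Tⱼ = begin
          + 2                              ≤⟨ ℤP.+-mono-≤ (0≤i→i≢0⇒1≤i (0≤slack (T ∩ T₀)) ∩-not-tight)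
                                                          (0≤i→i≢0⇒1≤i (0≤slack (T ⊔ T₀)) ⊔-not-tight) ⟩
          slack (T ∩ T₀) + slack (T ⊔ T₀)  ≤⟨ slack-submodular T T₀ ⟩
          slack T + slack T₀               ≡⟨ cong (ℤ._+_ (slack T)) T₀-tight ⟩
          slack T + + 0                    ≡⟨ ℤP.+-identityʳ (slack T) ⟩
          slack T                          ∎
          where
          open ℤP.≤-Reasoning
          ∩-not-tight : ¬ Tight (T ∩ T₀)
          ∩-not-tight = not-tight (T ∩ T₀)
            (trans (lookup-∩ T T₀ i) (trans (cong₂ ∩₁ Tᵢ T₀ᵢ) (∩₁-idem _)))
            (trans (lookup-∩ T T₀ j) (trans (cong₂ ∩₁ Tⱼ T₀ⱼ) (∩₁-inverseˡ bⱼ)))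
          ⊔-not-tight : ¬ Tight (T ⊔ T₀)
          ⊔-not-tight = not-tight (T ⊔ T₀)
            (trans (lookup-⊔ T T₀ i) (trans (cong₂ ⊔₁ Tᵢ T₀ᵢ) (⊔₁-idem _)))
            (trans (lookup-⊔ T T₀ j) (trans (cong₂ ⊔₁ Tⱼ T₀ⱼ) (⊔₁-inverseˡ bⱼ)))

        C-below : Below h C
        C-below T with + meet T C ℤ.≤? h T
        ... | yes ok = ok
        ... | no v   = ⊥-elim (cases (position (lookup T i) bᵢ) (position (lookup T j) bⱼ))
          where
          gᵢ = gain (lookup T i) bᵢ (not bᵢ)
          gⱼ = gain (lookup T j) bⱼ (not bⱼ)
          slack<gain : slack T < gᵢ + gⱼ
          slack<gain = subst (slack T <_) (meet-C T) (violation-slack v)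
          slack< : ∀ {x y} → gᵢ ≡ x → gⱼ ≡ y → slack T < x + y
          slack< eᵢ eⱼ = subst (slack T <_) (cong₂ _+_ eᵢ eⱼ) slack<gain
          nonpositive : ∀ {x y} → gᵢ ≡ x → gⱼ ≡ y → x + y ≤ + 0 → ⊥
          nonpositive eᵢ eⱼ = 0≤i<j≤0⇒⊥ (0≤slack T) (slack< eᵢ eⱼ)
          cases : Position bᵢ (lookup T i) → Position bⱼ (lookup T j) → ⊥
          cases (agrees eᵢ) _ = nonpositive (gain-agrees bᵢ eᵢ) refl (ℤP.+-monoʳ-≤ -[1+ 0 ] (gain≤1 (lookup T j) bⱼ))
          cases (absent eᵢ) (absent eⱼ) = nonpositive (gain-absent bᵢ eᵢ) (gain-absent bⱼ eⱼ) ℤP.≤-refl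
          cases (absent eᵢ) (agrees eⱼ) = nonpositive (gain-absent bᵢ eᵢ) (gain-agrees bⱼ eⱼ) ℤ.-≤+
          cases (disagrees eᵢ) (agrees eⱼ) = nonpositive (gain-disagrees bᵢ eᵢ) (gain-agrees bⱼ eⱼ) ℤP.≤-refl
          cases (disagrees eᵢ) (absent eⱼ) =
            not-tight T eᵢ eⱼ (0≤i<1⇒i≡0 (0≤slack T) (slack< (gain-disagrees bᵢ eᵢ) (gain-absent bⱼ eⱼ)))
          cases (absent eᵢ) (disagrees eⱼ) = not-tight (T ⊔ T₀)
            (trans (lookup-⊔ T T₀ i) (cong₂ ⊔₁ eᵢ T₀ᵢ))
            (trans (lookup-⊔ T T₀ j) (trans (cong₂ ⊔₁ eⱼ T₀ⱼ) (⊔₁-inverseˡ bⱼ)))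
            (proj₂ (tight-∩-⊔ (0≤i<1⇒i≡0 (0≤slack T) (slack< (gain-absent bᵢ eᵢ) (gain-disagrees bⱼ eⱼ)))
                              T₀-tight))
          cases (disagrees eᵢ) (disagrees eⱼ) =
            ℤP.<⇒≱ (slack< (gain-disagrees bᵢ eᵢ) (gain-disagrees bⱼ eⱼ)) (both-flipped⇒2≤slack T eᵢ eⱼ)

    exchange : Below h C₀ ⊎ ∃ λ j → lookup B j ≢ lookup B' j × j ≢ i × Below h (C₀ [ j ]≔ lookup B' j)
    exchange with all-or-counterexample (enumAdS n) (λ T → + meet T C₀ ℤ.≤? h T)
    ... | inj₁ C₀-below = inj₁ C₀-below
    ... | inj₂ (T₁ , T₁-violated) = inj₂ (j , Bⱼ≢B'ⱼ , S.j≢i T₀ⱼ Bⱼ≢B'ⱼ , S.C-below T₀ⱼ Bⱼ≢B'ⱼ)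
      where
      smallest : ∃ λ T₀ → ThroughFlip T₀ × ∀ T → ThroughFlip T → card T₀ ℕ.≤ card T
      smallest = least through-flip? (λ T T' → card T ℕ.≤ card T') (λ _ _ → ℕP.≤-total _ _)
                       (λ _ _ _ → ℕP.≤-trans) (enumAdS n) (T₁ , violated-C₀⇒through-flip T₁ T₁-violated)
      module S = Smallest (proj₁ smallest) (proj₁ (proj₁ (proj₂ smallest))) (proj₂ (proj₁ (proj₂ smallest)))
                          (proj₂ (proj₂ smallest))
      j = proj₁ S.witness
      T₀ⱼ = proj₁ (proj₂ S.witness)
      Bⱼ≢B'ⱼ = proj₂ (proj₂ S.witness)

eb : Bool → ℤ
eb b = if b then + 1 else - (+ 1)

val : ∀ {n} → Vec ℤ n → Full n → ℤ
val w B = w · eB B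

val-update : ∀ {n} (w : Vec ℤ n) (B : Full n) k c →
  val w (B [ k ]≔ c) ≡ val w B + (lookup w k * eb c - lookup w k * eb (lookup B k))
val-update (wₖ ∷ w) (b ∷ B) Fin.zero    c = regroup wₖ (eb c) (eb b) (val w B)
  where
  regroup : ∀ w c b v → w * c + v ≡ w * b + v + (w * c - w * b)
  regroup = solve-∀
val-update (w₀ ∷ w) (b ∷ B) (Fin.suc k) c =
  trans (cong (ℤ._+_ (w₀ * eb b)) (val-update w B k c)) (sym (ℤP.+-assoc (w₀ * eb b) (val w B) _))

val-+ : ∀ {n} (u v : Vec ℤ n) (y : Full n) → val (zipWith _+_ u v) y ≡ val u y + val v y
val-+ []      []      []      = refl
val-+ (a ∷ u) (b ∷ v) (c ∷ y) = trans (cong (ℤ._+_ ((a + b) * eb c)) (val-+ u v y)) (regroup a b (eb c) (val u y) (val v y))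
  where
  regroup : ∀ a b e u v → (a + b) * e + (u + v) ≡ a * e + u + (b * e + v)
  regroup = solve-∀

val-* : ∀ {n} (a : ℤ) (u : Vec ℤ n) (y : Full n) → val (map (a *_) u) y ≡ a * val u y
val-* a []      []      = sym (ℤP.*-zeroʳ a)
val-* a (b ∷ u) (c ∷ y) = trans (cong (ℤ._+_ (a * b * eb c)) (val-* a u y)) (regroup a b (eb c) (val u y))
  where
  regroup : ∀ a b e u → a * b * e + a * u ≡ a * (b * e + u)
  regroup = solve-∀

slope : ∀ {n} → Vec ℤ n → Full n → Full n → Fin n → ℤ
slope w X Y k = lookup w k * eb (lookup Y k) - lookup w k * eb (lookup X k)

slope-swap : ∀ {n} (w : Vec ℤ n) X Y k → slope w Y X k ≡ - slope w X Y k
slope-swap w X Y k = negate (lookup w k * eb (lookup X k)) (lookup w k * eb (lookup Y k))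
  where
  negate : ∀ a b → a - b ≡ - (b - a)
  negate = solve-∀

Covers : ∀ {n} → Full n → Full n → Fin n → Fin n → Set
Covers B B' i j = ∀ k → lookup B k ≢ lookup B' k → k ≡ i ⊎ k ≡ j

covered? : ∀ {n} (B B' : Full n) → Dec (∃ λ i → ∃ λ j → Covers B B' i j)
covered? B B' = FinP.any? λ i → FinP.any? λ j → FinP.all? λ k →
  ¬? (lookup B k BoolP.≟ lookup B' k) →-dec (k FinP.≟ i ⊎-dec k FinP.≟ j)

agrees-outside⇒covers : ∀ {n} (X : Full n) {Y C : Full n} {i j} →
  (∀ k → k ≢ i → k ≢ j → lookup C k ≡ lookup X k) → C ≡ Y → Covers X Y i j
agrees-outside⇒covers X {i = i} {j} agree refl k Xₖ≢Cₖ with k FinP.≟ i | k FinP.≟ j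
... | yes k≡i | _       = inj₁ k≡i
... | no _    | yes k≡j = inj₂ k≡j
... | no k≢i  | no k≢j  = ⊥-elim (Xₖ≢Cₖ (sym (agree k k≢i k≢j)))

differs? : ∀ {n} (B B' : Full n) → Decidable λ k → lookup B k ≢ lookup B' k
differs? B B' k = ¬? (lookup B k BoolP.≟ lookup B' k)

some-difference : ∀ {n} {B B' : Full n} → B ≢ B' → ∃ λ k → lookup B k ≢ lookup B' k
some-difference {n} {B} {B'} B≢B' =
  FinP.¬∀⟶∃¬ n _ (λ k → lookup B k BoolP.≟ lookup B' k) (λ all → B≢B' (Pointwise-≡⇒≡ (ext all)))

covers⇒agree : ∀ {n} (B B' : Full n) {i j} → Covers B B' i j → ∀ k → k ≢ i → k ≢ j → lookup B k ≡ lookup B' k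
covers⇒agree B B' cov k k≢i k≢j with lookup B k BoolP.≟ lookup B' k
... | yes Bₖ≡B'ₖ = Bₖ≡B'ₖ
... | no Bₖ≢B'ₖ with cov k Bₖ≢B'ₖ
...   | inj₁ k≡i = ⊥-elim (k≢i k≡i)
...   | inj₂ k≡j = ⊥-elim (k≢j k≡j)

covers-shrink : ∀ {n} (B B' : Full n) {i j} → Covers B B' i j → lookup B j ≡ lookup B' j → Covers B B' i i
covers-shrink B B' cov Bⱼ≡B'ⱼ k Bₖ≢B'ₖ with cov k Bₖ≢B'ₖ
... | inj₁ k≡i = inj₁ k≡i
... | inj₂ refl = ⊥-elim (Bₖ≢B'ₖ Bⱼ≡B'ⱼ)

covers-comm : ∀ {n} (B B' : Full n) {i j} → Covers B B' i j → Covers B B' j i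
covers-comm B B' cov k Bₖ≢B'ₖ with cov k Bₖ≢B'ₖ
... | inj₁ k≡i = inj₂ k≡i
... | inj₂ k≡j = inj₁ k≡j

difference : ∀ {n} → Full n → Full n → Vec ℤ n
difference B B' = zipWith _-_ (eB B) (eB B')

Direction : ∀ {n} → Full n → Full n → Fin n → Fin n → Set
Direction B B' i j = Parallel (difference B B') (unit i)
  ⊎ Parallel (difference B B') (zipWith ℤ._+_ (unit i) (unit j))
  ⊎ Parallel (difference B B') (zipWith _-_ (unit i) (unit j))

EdgeDirection : ∀ {n} → Full n → Full n → Set
EdgeDirection B B' = ∃[ i ] ∃[ j ] Direction B B' i j

lookup-difference : ∀ {n} (B B' : Full n) k → lookup (difference B B') k ≡ eb (lookup B k) - eb (lookup B' k)
lookup-difference B B' k = trans (VecP.lookup-zipWith _-_ k (eB B) (eB B'))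
  (cong₂ _-_ (VecP.lookup-map k _ B) (VecP.lookup-map k _ B'))

difference-agree : ∀ {n} (B B' : Full n) k → lookup B k ≡ lookup B' k → lookup (difference B B') k ≡ + 0
difference-agree B B' k Bₖ≡B'ₖ = trans (lookup-difference B B' k)
  (trans (cong (λ b → eb b - eb (lookup B' k)) Bₖ≡B'ₖ) (ℤP.+-inverseʳ (eb (lookup B' k))))

difference-disagree : ∀ {n} (B B' : Full n) k → lookup B k ≢ lookup B' k →
  lookup (difference B B') k ≡ + 2 * eb (lookup B k)
difference-disagree B B' k Bₖ≢B'ₖ = trans (lookup-difference B B' k) (go (lookup B k) (lookup B' k) Bₖ≢B'ₖ)
  where
  go : ∀ b b' → b ≢ b' → eb b - eb b' ≡ + 2 * eb b
  go true  true  b≢b' = ⊥-elim (b≢b' refl)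
  go true  false _    = refl
  go false true  _    = refl
  go false false b≢b' = ⊥-elim (b≢b' refl)

2eb≢0 : ∀ b → + 2 * eb b ≢ + 0
2eb≢0 true  ()
2eb≢0 false ()

unit-self : ∀ {n} (i : Fin n) → lookup (unit i) i ≡ + 1
unit-self i with i Fin.≟ i | VecP.lookup∘tabulate (λ k → if ⌊ k Fin.≟ i ⌋ then + 1 else + 0) i
... | yes _   | e = e
... | no i≢i | _ = ⊥-elim (i≢i refl)

unit-other : ∀ {n} (i k : Fin n) → k ≢ i → lookup (unit i) k ≡ + 0
unit-other i k k≢i with k Fin.≟ i | VecP.lookup∘tabulate (λ k → if ⌊ k Fin.≟ i ⌋ then + 1 else + 0) k
... | yes k≡i | _ = ⊥-elim (k≢i k≡i)
... | no _    | e = e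

parallel-by-cases : ∀ {n} {u v : Vec ℤ n} (i j : Fin n) (b : ℤ) → b ≢ + 0 →
  lookup u i ≡ b * lookup v i → lookup u j ≡ b * lookup v j →
  (∀ k → k ≢ i → k ≢ j → lookup u k ≡ + 0 × lookup v k ≡ + 0) → Parallel u v
parallel-by-cases {u = u} {v} i j b b≢0 uᵢ uⱼ elsewhere = + 1 , b , (λ ()) , b≢0 , Pointwise-≡⇒≡ (ext pointwise)
  where
  value : ∀ k → lookup u k ≡ b * lookup v k
  value k with k Fin.≟ i | k Fin.≟ j
  ... | yes refl | _        = uᵢ
  ... | no _     | yes refl = uⱼ
  ... | no k≢i   | no k≢j   = trans (proj₁ (elsewhere k k≢i k≢j))
                                (sym (trans (cong (b *_) (proj₂ (elsewhere k k≢i k≢j))) (ℤP.*-zeroʳ b)))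
  pointwise : ∀ k → lookup (map (+ 1 *_) u) k ≡ lookup (map (b *_) v) k
  pointwise k = trans (VecP.lookup-map k _ u) (trans (ℤP.*-identityˡ _) (trans (value k) (sym (VecP.lookup-map k _ v))))

single-direction : ∀ {n} {B B' : Full n} i → lookup B i ≢ lookup B' i → Covers B B' i i → EdgeDirection B B'
single-direction {B = B} {B'} i Bᵢ≢B'ᵢ cov =
  i , i , inj₁ (parallel-by-cases i i b (2eb≢0 (lookup B i)) dᵢ dᵢ elsewhere)
  where
  b = + 2 * eb (lookup B i)
  dᵢ : lookup (difference B B') i ≡ b * lookup (unit i) i
  dᵢ = trans (difference-disagree B B' i Bᵢ≢B'ᵢ) (sym (trans (cong (b *_) (unit-self i)) (ℤP.*-identityʳ b)))
  elsewhere : ∀ k → k ≢ i → k ≢ i → lookup (difference B B') k ≡ + 0 × lookup (unit i) k ≡ + 0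
  elsewhere k k≢i _ = difference-agree B B' k (covers⇒agree B B' cov k k≢i k≢i) , unit-other i k k≢i

2eb-not : ∀ b → + 2 * eb (not b) ≡ + 2 * eb b * -[1+ 0 ]
2eb-not true  = refl
2eb-not false = refl

pair-parallel : ∀ {n} {B B' : Full n} (_∙_ : ℤ → ℤ → ℤ) {σ : ℤ} i j → j ≢ i →
  lookup B i ≢ lookup B' i → lookup B j ≢ lookup B' j → Covers B B' i j →
  (+ 1) ∙ (+ 0) ≡ + 1 → (+ 0) ∙ (+ 1) ≡ σ → (+ 0) ∙ (+ 0) ≡ + 0 →
  + 2 * eb (lookup B j) ≡ + 2 * eb (lookup B i) * σ →
  Parallel (difference B B') (zipWith _∙_ (unit i) (unit j))
pair-parallel {B = B} {B'} _∙_ {σ} i j j≢i Bᵢ≢B'ᵢ Bⱼ≢B'ⱼ cov 1∙0≡1 0∙1≡σ 0∙0≡0 Bⱼ-vs-Bᵢ =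
  parallel-by-cases i j b (2eb≢0 (lookup B i)) dᵢ dⱼ elsewhere
  where
  open ≡-Reasoning
  b = + 2 * eb (lookup B i)
  v = zipWith _∙_ (unit i) (unit j)
  lookup-v : ∀ k → lookup v k ≡ lookup (unit i) k ∙ lookup (unit j) k
  lookup-v k = VecP.lookup-zipWith _∙_ k (unit i) (unit j)
  dᵢ : lookup (difference B B') i ≡ b * lookup v i
  dᵢ = begin
    lookup (difference B B') i                ≡⟨ difference-disagree B B' i Bᵢ≢B'ᵢ ⟩
    b                                         ≡⟨ ℤP.*-identityʳ b ⟨
    b * + 1                                   ≡⟨ cong (b *_) 1∙0≡1 ⟨
    b * ((+ 1) ∙ (+ 0))                           ≡⟨ cong (λ r → b * r) (cong₂ _∙_ (unit-self i) (unit-other j i (≢-sym j≢i))) ⟨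
    b * (lookup (unit i) i ∙ lookup (unit j) i) ≡⟨ cong (b *_) (lookup-v i) ⟨
    b * lookup v i                            ∎
  dⱼ : lookup (difference B B') j ≡ b * lookup v j
  dⱼ = begin
    lookup (difference B B') j                ≡⟨ difference-disagree B B' j Bⱼ≢B'ⱼ ⟩
    + 2 * eb (lookup B j)                     ≡⟨ Bⱼ-vs-Bᵢ ⟩
    b * σ                                     ≡⟨ cong (b *_) 0∙1≡σ ⟨
    b * ((+ 0) ∙ (+ 1))                           ≡⟨ cong (λ r → b * r) (cong₂ _∙_ (unit-other i j j≢i) (unit-self j)) ⟨
    b * (lookup (unit i) j ∙ lookup (unit j) j) ≡⟨ cong (b *_) (lookup-v j) ⟨
    b * lookup v j                            ∎
  elsewhere : ∀ k → k ≢ i → k ≢ j → lookup (difference B B') k ≡ + 0 × lookup v k ≡ + 0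
  elsewhere k k≢i k≢j = difference-agree B B' k (covers⇒agree B B' cov k k≢i k≢j) ,
    trans (lookup-v k) (trans (cong₂ _∙_ (unit-other i k k≢i) (unit-other j k k≢j)) 0∙0≡0)

pair-direction : ∀ {n} {B B' : Full n} i j → j ≢ i → lookup B i ≢ lookup B' i → lookup B j ≢ lookup B' j →
  Covers B B' i j → EdgeDirection B B'
pair-direction {B = B} i j j≢i Bᵢ≢B'ᵢ Bⱼ≢B'ⱼ cov with lookup B j BoolP.≟ lookup B i
... | yes Bⱼ≡Bᵢ = i , j , inj₂ (inj₁ (pair-parallel _+_ i j j≢i Bᵢ≢B'ᵢ Bⱼ≢B'ⱼ cov refl refl refl
  (trans (cong (λ c → + 2 * eb c) Bⱼ≡Bᵢ) (sym (ℤP.*-identityʳ _)))))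
... | no Bⱼ≢Bᵢ  = i , j , inj₂ (inj₂ (pair-parallel _-_ i j j≢i Bᵢ≢B'ᵢ Bⱼ≢B'ⱼ cov refl refl refl
  (trans (cong (λ c → + 2 * eb c) (BoolP.¬-not Bⱼ≢Bᵢ)) (2eb-not (lookup B i)))))

covers⇒direction : ∀ {n} {B B' : Full n} → B ≢ B' → (∃ λ i → ∃ λ j → Covers B B' i j) → EdgeDirection B B'
covers⇒direction {B = B} {B'} B≢B' (i , j , cov)
  with lookup B i BoolP.≟ lookup B' i | lookup B j BoolP.≟ lookup B' j | j Fin.≟ i
... | no Bᵢ≢B'ᵢ | no Bⱼ≢B'ⱼ | no j≢i  = pair-direction i j j≢i Bᵢ≢B'ᵢ Bⱼ≢B'ⱼ cov
... | no Bᵢ≢B'ᵢ | no _      | yes refl = single-direction i Bᵢ≢B'ᵢ cov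
... | no Bᵢ≢B'ᵢ | yes Bⱼ≡B'ⱼ | _      = single-direction i Bᵢ≢B'ᵢ (covers-shrink B B' cov Bⱼ≡B'ⱼ)
... | yes Bᵢ≡B'ᵢ | no Bⱼ≢B'ⱼ | _      =
  single-direction j Bⱼ≢B'ⱼ (covers-shrink B B' (covers-comm B B' cov) Bᵢ≡B'ᵢ)
... | yes Bᵢ≡B'ᵢ | yes Bⱼ≡B'ⱼ | _     = ⊥-elim (B≢B' (Pointwise-≡⇒≡ (ext agree)))
  where
  agree : ∀ k → lookup B k ≡ lookup B' k
  agree k with lookup B k BoolP.≟ lookup B' k
  ... | yes Bₖ≡B'ₖ = Bₖ≡B'ₖ
  ... | no Bₖ≢B'ₖ with covers-shrink B B' cov Bⱼ≡B'ⱼ k Bₖ≢B'ₖ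
  ...   | inj₁ refl = ⊥-elim (Bₖ≢B'ₖ Bᵢ≡B'ᵢ)
  ...   | inj₂ refl = ⊥-elim (Bₖ≢B'ₖ Bᵢ≡B'ᵢ)

direction⇒covers : ∀ {n} {B B' : Full n} → EdgeDirection B B' → ∃ λ i → ∃ λ j → Covers B B' i j
direction⇒covers {B = B} {B'} (i , j , parallel) = i , j , covers
  where
  d = difference B B'
  vanishes⇒agree : ∀ {r} k → Parallel d r → lookup r k ≡ + 0 → lookup B k ≡ lookup B' k
  vanishes⇒agree {r} k (a , b , a≢0 , _ , ad≡br) rₖ≡0 with lookup B k BoolP.≟ lookup B' k
  ... | yes Bₖ≡B'ₖ = Bₖ≡B'ₖ
  ... | no Bₖ≢B'ₖ = ⊥-elim ([ a≢0 , (λ dₖ≡0 → 2eb≢0 (lookup B k) (trans (sym (difference-disagree B B' k Bₖ≢B'ₖ)) dₖ≡0)) ]′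
                             (ℤP.i*j≡0⇒i≡0∨j≡0 a adₖ≡0))
    where
    adₖ≡0 : a * lookup d k ≡ + 0
    adₖ≡0 = begin
      a * lookup d k           ≡⟨ VecP.lookup-map k (a *_) d ⟨
      lookup (map (a *_) d) k  ≡⟨ cong (λ v → lookup v k) ad≡br ⟩
      lookup (map (b *_) r) k  ≡⟨ VecP.lookup-map k (b *_) r ⟩
      b * lookup r k           ≡⟨ cong (b *_) rₖ≡0 ⟩
      b * + 0                  ≡⟨ ℤP.*-zeroʳ b ⟩
      + 0                      ∎
      where open ≡-Reasoning
  covers : Covers B B' i j
  covers k Bₖ≢B'ₖ with k Fin.≟ i | k Fin.≟ j
  ... | yes k≡i | _       = inj₁ k≡i
  ... | no _    | yes k≡j = inj₂ k≡j
  ... | no k≢i  | no k≢j  = ⊥-elim (Bₖ≢B'ₖ (agree parallel))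
    where
    agree : Direction B B' i j → lookup B k ≡ lookup B' k
    agree (inj₁ p)        = vanishes⇒agree k p (unit-other i k k≢i)
    agree (inj₂ (inj₁ p)) = vanishes⇒agree k p (trans (VecP.lookup-zipWith _+_ k (unit i) (unit j))
                                                       (cong₂ _+_ (unit-other i k k≢i) (unit-other j k k≢j)))
    agree (inj₂ (inj₂ p)) = vanishes⇒agree k p (trans (VecP.lookup-zipWith _-_ k (unit i) (unit j))
                                                       (cong₂ _-_ (unit-other i k k≢i) (unit-other j k k≢j)))

covers⇒two-updates : ∀ {n} (x z : Full n) {i j} → Covers x z i j → z ≡ x [ i ]≔ lookup z i [ j ]≔ lookup z j
covers⇒two-updates x z {i} {j} cov = Pointwise-≡⇒≡ (ext pointwise)
  where
  y = x [ i ]≔ lookup z i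
  pointwise : ∀ k → lookup z k ≡ lookup (y [ j ]≔ lookup z j) k
  pointwise k with k Fin.≟ j
  ... | yes refl = sym (VecP.lookup∘update k y (lookup z k))
  ... | no k≢j with k Fin.≟ i
  ...   | yes refl = sym (trans (VecP.lookup∘update′ k≢j y (lookup z j)) (VecP.lookup∘update k x (lookup z k)))
  ...   | no k≢i   = sym (trans (VecP.lookup∘update′ k≢j y (lookup z j))
                         (trans (VecP.lookup∘update′ k≢i x (lookup z i)) (covers⇒agree x z cov k k≢i k≢j)))

-- From the axioms to a delta-matroid

module _ {n} {h : AdS n → ℤ} (ax : HAxioms h) (w : Vec ℤ n) where

  improving-pair : ∀ {X Y} → Below h X → Below h Y →
    (∀ C → Below h C → C ≢ X → C ≢ Y → val w C < val w X) → ¬ (∃ λ i → ∃ λ j → Covers X Y i j) →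
    ∀ i → lookup X i ≢ lookup Y i → ∃ λ j → lookup X j ≢ lookup Y j × slope w X Y i + slope w X Y j < + 0
  improving-pair {X} {Y} X-below Y-below X-strict-max uncovered i Xᵢ≢Yᵢ
    with Exchange.exchange ax X-below Y-below Xᵢ≢Yᵢ
  ... | inj₁ C₀-below = i , Xᵢ≢Yᵢ , ℤP.+-mono-< sᵢ<0 sᵢ<0
    where
    C₀ = X [ i ]≔ lookup Y i
    sᵢ<0 : slope w X Y i < + 0
    sᵢ<0 = i+j<i⇒j<0 (subst (_< val w X) (val-update w X i (lookup Y i))
      (X-strict-max C₀ C₀-below
        (λ C₀≡X → Xᵢ≢Yᵢ (trans (cong (λ V → lookup V i) (sym C₀≡X)) (VecP.lookup∘update i X (lookup Y i))))
        (λ C₀≡Y → uncovered (i , i , agrees-outside⇒covers X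
                   (λ k k≢i _ → VecP.lookup∘update′ k≢i X (lookup Y i)) C₀≡Y))))
  ... | inj₂ (j , Xⱼ≢Yⱼ , j≢i , C-below) = j , Xⱼ≢Yⱼ , i+j<i⇒j<0 (subst (_< val w X) val-C
      (X-strict-max C C-below
        (λ C≡X → Xⱼ≢Yⱼ (trans (cong (λ V → lookup V j) (sym C≡X)) (VecP.lookup∘update j C₀ (lookup Y j))))
        (λ C≡Y → uncovered (i , j , agrees-outside⇒covers X
                   (λ k k≢i k≢j → trans (VecP.lookup∘update′ k≢j C₀ (lookup Y j))
                                        (VecP.lookup∘update′ k≢i X (lookup Y i)))
                   C≡Y))))
    where
    C₀ = X [ i ]≔ lookup Y i
    C = C₀ [ j ]≔ lookup Y j
    val-C : val w C ≡ val w X + (slope w X Y i + slope w X Y j)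
    val-C = begin
      val w C
        ≡⟨ val-update w C₀ j (lookup Y j) ⟩
      val w C₀ + (lookup w j * eb (lookup Y j) - lookup w j * eb (lookup C₀ j))
        ≡⟨ cong₂ (λ v c → v + (lookup w j * eb (lookup Y j) - lookup w j * eb c))
                 (val-update w X i (lookup Y i)) (VecP.lookup∘update′ j≢i X (lookup Y i)) ⟩
      val w X + slope w X Y i + slope w X Y j
        ≡⟨ ℤP.+-assoc (val w X) _ _ ⟩
      val w X + (slope w X Y i + slope w X Y j) ∎
      where open ≡-Reasoning

  unique-max⇒strict : ∀ {B B'} → (∀ C → Below h C → val w C ≤ val w B) →
    (∀ C → Below h C → val w C ≡ val w B → C ≡ B ⊎ C ≡ B') →
    ∀ C → Below h C → C ≢ B → C ≢ B' → val w C < val w B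
  unique-max⇒strict maximal only C C-below C≢B C≢B' =
    ℤP.≤∧≢⇒< (maximal C C-below) λ tie → [ C≢B , C≢B' ]′ (only C C-below tie)

  -- If B and B' differed outside every pair of coordinates, exchanging from B at a coordinate of largest
  -- slope and from B' at one of smallest slope would produce pairs of slopes of opposite signs.
  edge⇒covered : ∀ {B B'} → Below h B → Below h B' → B ≢ B' →
    (∀ C → Below h C → val w C ≤ val w B) → val w B ≡ val w B' →
    (∀ C → Below h C → val w C ≡ val w B → C ≡ B ⊎ C ≡ B') →
    ∃ λ i → ∃ λ j → Covers B B' i j
  edge⇒covered {B} {B'} B-below B'-below B≢B' maximal tie only with covered? B B'
  ... | yes covered  = covered
  ... | no uncovered
    with least (differs? B B') (λ a b → slope w B B' b ≤ slope w B B' a) (λ _ _ → ℤP.≤-total _ _)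
               (λ _ _ _ p q → ℤP.≤-trans q p) (enumFin n) (some-difference B≢B')
       | least (differs? B B') (λ a b → slope w B B' a ≤ slope w B B' b) (λ _ _ → ℤP.≤-total _ _)
               (λ _ _ _ → ℤP.≤-trans) (enumFin n) (some-difference B≢B')
  ... | M , M-differs , M-max | m , m-differs , m-min
    with improving-pair B-below B'-below (unique-max⇒strict maximal only) uncovered M M-differs
       | improving-pair B'-below B-below
           (λ C C-below C≢B' C≢B → subst (val w C <_) tie (unique-max⇒strict maximal only C C-below C≢B C≢B'))
           (λ { (i , j , covered) → uncovered (i , j , λ k d → covered k (≢-sym d)) }) m (≢-sym m-differs)
  ... | j , j-differs , sM+sj<0 | j′ , j′-differs , s′m+s′j′<0 = ⊥-elim (ℤP.<-asym 0<sm+sj′ (begin-strict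
    s m + s j′  ≤⟨ ℤP.+-mono-≤ (m-min j j-differs) (M-max j′ (≢-sym j′-differs)) ⟩
    s j + s M   ≡⟨ ℤP.+-comm (s j) (s M) ⟩
    s M + s j   <⟨ sM+sj<0 ⟩
    + 0         ∎))
    where
    open ℤP.≤-Reasoning
    s : Fin n → ℤ
    s = slope w B B'
    0<sm+sj′ : + 0 < s m + s j′
    0<sm+sj′ = ℤP.neg-cancel-< (subst (_< + 0)
      (trans (cong₂ _+_ (slope-swap w B B' m) (slope-swap w B B' j′)) (sym (ℤP.neg-distrib-+ (s m) (s j′))))
      s′m+s′j′<0)

below? : ∀ {n} (h : AdS n → ℤ) B → Dec (Below h B)
below? {n} h B with all-or-counterexample (enumAdS n) (λ T → + meet T B ℤ.≤? h T)
... | inj₁ below          = yes below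
... | inj₂ (T , violated) = no λ below → violated (below T)

feasibleOf : ∀ {n} → (AdS n → ℤ) → Full n → Bool
feasibleOf h B = isYes (below? h B)

feasible⇔below : ∀ {n} (h : AdS n → ℤ) B → Feasible (feasibleOf h) B ⇔ Below h B
feasible⇔below h B = mk⇔ (λ B∈F → toWitness (Equivalence.from BoolP.T-≡ B∈F))
                        (λ below → Equivalence.to BoolP.T-≡ (fromWitness below))

axioms⇒deltaMatroid : ∀ {n} {h : AdS n → ℤ} → HAxioms h →
  Σ (Full n → Bool) λ F → IsDeltaMatroid F × (∀ S → IsHValue F S (h S))
axioms⇒deltaMatroid {n} {h} ax = F , (nonempty , edge-direction) , h-value
  where
  F = feasibleOf h
  feasible⇒below : ∀ {B} → Feasible F B → Below h B
  feasible⇒below {B} = Equivalence.to (feasible⇔below h B)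
  below⇒feasible : ∀ {B} → Below h B → Feasible F B
  below⇒feasible {B} = Equivalence.from (feasible⇔below h B)
  nonempty : ∃ λ B → Feasible F B
  nonempty with tight-below ax ∅
  ... | B , B-below , _ = B , below⇒feasible B-below
  edge-direction : ∀ B B' → IsEdge F B B' → EdgeDirection B B'
  edge-direction B B' (B∈F , B'∈F , B≢B' , w , maximal , tie , only) = covers⇒direction B≢B'
    (edge⇒covered ax w (feasible⇒below B∈F) (feasible⇒below B'∈F) B≢B'
       (λ C C-below → maximal C (below⇒feasible C-below)) tie (λ C C-below → only C (below⇒feasible C-below)))
  h-value : ∀ S → IsHValue F S (h S)
  h-value S with tight-below ax S
  ... | B , B-below , tight =
    maxMeet⇒hValue F S (h S) ((B , below⇒feasible B-below , tight) , λ B' B'∈F → feasible⇒below B'∈F S)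

-- Improving edges of a 0/±1 polytope

differ : Bool → Bool → ℕ
differ true  true  = 0
differ true  false = 1
differ false true  = 1
differ false false = 0

dist : ∀ {n} → Full n → Full n → ℕ
dist []      []      = 0
dist (a ∷ x) (b ∷ y) = differ a b ℕ.+ dist x y

dist≡0⇒≡ : ∀ {n} (x y : Full n) → dist x y ≡ 0 → x ≡ y
dist≡0⇒≡ []          []          _ = refl
dist≡0⇒≡ (true ∷ x)  (true ∷ y)  d = cong (true ∷_) (dist≡0⇒≡ x y d)
dist≡0⇒≡ (false ∷ x) (false ∷ y) d = cong (false ∷_) (dist≡0⇒≡ x y d)

val-eB : ∀ {n} (x y : Full n) → val (eB x) y + + 2 * + dist x y ≡ val (eB x) x
val-eB []      []      = refl
val-eB (a ∷ x) (b ∷ y) = begin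
  eb a * eb b + val (eB x) y + + 2 * + (differ a b ℕ.+ dist x y)
    ≡⟨ cong (λ d → eb a * eb b + val (eB x) y + + 2 * d) (ℤP.pos-+ (differ a b) (dist x y)) ⟩
  eb a * eb b + val (eB x) y + + 2 * (+ differ a b + + dist x y)
    ≡⟨ regroup (eb a * eb b) (val (eB x) y) (+ differ a b) (+ dist x y) ⟩
  (eb a * eb b + + 2 * + differ a b) + (val (eB x) y + + 2 * + dist x y)
    ≡⟨ cong₂ _+_ (coordinate a b) (val-eB x y) ⟩
  eb a * eb a + val (eB x) x ∎
  where
  open ≡-Reasoning
  regroup : ∀ p v d e → p + v + + 2 * (d + e) ≡ (p + + 2 * d) + (v + + 2 * e)
  regroup = solve-∀
  coordinate : ∀ a b → eb a * eb b + + 2 * + differ a b ≡ eb a * eb a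
  coordinate true  true  = refl
  coordinate true  false = refl
  coordinate false true  = refl
  coordinate false false = refl

agreementₖ : Bool → Bool → ℤ
agreementₖ true  true  = + 1
agreementₖ true  false = + 0
agreementₖ false true  = + 0
agreementₖ false false = -[1+ 0 ]

agreement : ∀ {n} → Full n → Full n → Vec ℤ n
agreement = zipWith agreementₖ

leaves : Bool → Bool → Bool → ℕ
leaves true  true  false = 1
leaves false false true  = 1
leaves _     _     _     = 0

leaving : ∀ {n} → Full n → Full n → Full n → ℕ
leaving []      []      []      = 0
leaving (a ∷ x) (b ∷ z) (c ∷ y) = leaves a b c ℕ.+ leaving x z y

val-agreement : ∀ {n} (x z y : Full n) → val (agreement x z) y + + 2 * + leaving x z y ≡ val (agreement x z) x
val-agreement []      []      []      = refl
val-agreement (a ∷ x) (b ∷ z) (c ∷ y) = begin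
  agreementₖ a b * eb c + val (agreement x z) y + + 2 * + (leaves a b c ℕ.+ leaving x z y)
    ≡⟨ cong (λ d → agreementₖ a b * eb c + val (agreement x z) y + + 2 * d) (ℤP.pos-+ (leaves a b c) (leaving x z y)) ⟩
  agreementₖ a b * eb c + val (agreement x z) y + + 2 * (+ leaves a b c + + leaving x z y)
    ≡⟨ regroup (agreementₖ a b * eb c) (val (agreement x z) y) (+ leaves a b c) (+ leaving x z y) ⟩
  (agreementₖ a b * eb c + + 2 * + leaves a b c) + (val (agreement x z) y + + 2 * + leaving x z y)
    ≡⟨ cong₂ _+_ (coordinate a b c) (val-agreement x z y) ⟩
  agreementₖ a b * eb a + val (agreement x z) x ∎
  where
  open ≡-Reasoning
  regroup : ∀ p v d e → p + v + + 2 * (d + e) ≡ (p + + 2 * d) + (v + + 2 * e)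
  regroup = solve-∀
  coordinate : ∀ a b c → agreementₖ a b * eb c + + 2 * + leaves a b c ≡ agreementₖ a b * eb a
  coordinate true  true  true  = refl
  coordinate true  true  false = refl
  coordinate true  false true  = refl
  coordinate true  false false = refl
  coordinate false true  true  = refl
  coordinate false true  false = refl
  coordinate false false true  = refl
  coordinate false false false = refl

leaving-self : ∀ {n} (x z : Full n) → leaving x z z ≡ 0
leaving-self []          []          = refl
leaving-self (true ∷ x)  (true ∷ z)  = leaving-self x z
leaving-self (true ∷ x)  (false ∷ z) = leaving-self x z
leaving-self (false ∷ x) (true ∷ z)  = leaving-self x z
leaving-self (false ∷ x) (false ∷ z) = leaving-self x z

not-leaving⇒dist≤ : ∀ {n} (x z y : Full n) → leaving x z y ≡ 0 → dist x y ℕ.≤ dist x z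
not-leaving⇒dist≤ []          []          []          _ = ℕ.z≤n
not-leaving⇒dist≤ (true ∷ x)  (true ∷ z)  (true ∷ y)  l = not-leaving⇒dist≤ x z y l
not-leaving⇒dist≤ (false ∷ x) (false ∷ z) (false ∷ y) l = not-leaving⇒dist≤ x z y l
not-leaving⇒dist≤ (true ∷ x)  (false ∷ z) (c ∷ y)     l =
  ℕP.+-mono-≤ (differ≤1 c) (not-leaving⇒dist≤ x z y (ℕP.m+n≡0⇒n≡0 (leaves true false c) l))
  where
  differ≤1 : ∀ c → differ true c ℕ.≤ 1
  differ≤1 true  = ℕ.z≤n
  differ≤1 false = ℕP.≤-refl
not-leaving⇒dist≤ (false ∷ x) (true ∷ z)  (c ∷ y)     l =
  ℕP.+-mono-≤ (differ≤1 c) (not-leaving⇒dist≤ x z y (ℕP.m+n≡0⇒n≡0 (leaves false true c) l))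
  where
  differ≤1 : ∀ c → differ false c ℕ.≤ 1
  differ≤1 true  = ℕP.≤-refl
  differ≤1 false = ℕ.z≤n
not-leaving⇒dist≤ (true ∷ x)  (true ∷ z)  (false ∷ y) ()
not-leaving⇒dist≤ (false ∷ x) (false ∷ z) (true ∷ y)  ()

not-leaving∧dist≥⇒≡ : ∀ {n} (x z y : Full n) → leaving x z y ≡ 0 → dist x z ℕ.≤ dist x y → y ≡ z
not-leaving∧dist≥⇒≡ []          []          []          _ _ = refl
not-leaving∧dist≥⇒≡ (true ∷ x)  (true ∷ z)  (true ∷ y)  l d = cong (true ∷_) (not-leaving∧dist≥⇒≡ x z y l d)
not-leaving∧dist≥⇒≡ (false ∷ x) (false ∷ z) (false ∷ y) l d = cong (false ∷_) (not-leaving∧dist≥⇒≡ x z y l d)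
not-leaving∧dist≥⇒≡ (true ∷ x)  (false ∷ z) (false ∷ y) l d = cong (false ∷_) (not-leaving∧dist≥⇒≡ x z y l (ℕP.+-cancelˡ-≤ 1 _ _ d))
not-leaving∧dist≥⇒≡ (false ∷ x) (true ∷ z)  (true ∷ y)  l d = cong (true ∷_) (not-leaving∧dist≥⇒≡ x z y l (ℕP.+-cancelˡ-≤ 1 _ _ d))
not-leaving∧dist≥⇒≡ (true ∷ x)  (false ∷ z) (true ∷ y)  l d = ⊥-elim (ℕP.<-irrefl refl (ℕP.≤-trans d (not-leaving⇒dist≤ x z y l)))
not-leaving∧dist≥⇒≡ (false ∷ x) (true ∷ z)  (false ∷ y) l d = ⊥-elim (ℕP.<-irrefl refl (ℕP.≤-trans d (not-leaving⇒dist≤ x z y l)))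
not-leaving∧dist≥⇒≡ (true ∷ x)  (true ∷ z)  (false ∷ y) ()
not-leaving∧dist≥⇒≡ (false ∷ x) (false ∷ z) (true ∷ y)  ()

-- y* minimises dist x y / γ y over the improving y. Then x maximises w = γ y* · e_x + 2 dist x y* · c
-- over F with y* among the ties, and W perturbs w so that only x and the tie z nearest to x stay maximal.
module ImprovingEdge {n} (F : Full n → Bool) {x : Full n} (x∈F : Feasible F x) (c : Vec ℤ n) where

  Δ : Full n → ℤ
  Δ y = + dist x y

  γ : Full n → ℤ
  γ y = val c y - val c x

  Improving : Full n → Set
  Improving y = Feasible F y × + 0 < γ y

  improving? : Decidable Improving
  improving? y = (F y Bool.≟ true) ×-dec (+ 0 ℤ.<? γ y)

  _≼_ : Full n → Full n → Set
  y ≼ y' = Δ y * γ y' ≤ Δ y' * γ y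

  ≼-trans : ∀ {y₁ y₂ y₃} → Improving y₁ → Improving y₂ → Improving y₃ → y₁ ≼ y₂ → y₂ ≼ y₃ → y₁ ≼ y₃
  ≼-trans {y₁} {y₂} {y₃} (_ , 0<γ₁) (_ , 0<γ₂) (_ , 0<γ₃) y₁≼y₂ y₂≼y₃ =
    ℤP.*-cancelˡ-≤-pos _ _ (γ y₂) {{ℤ.positive 0<γ₂}} (begin
      γ y₂ * (Δ y₁ * γ y₃)  ≡⟨ swap (γ y₂) (Δ y₁) (γ y₃) ⟩
      γ y₃ * (Δ y₁ * γ y₂)  ≤⟨ ℤP.*-monoˡ-≤-nonNeg (γ y₃) {{ℤ.nonNegative (ℤP.<⇒≤ 0<γ₃)}} y₁≼y₂ ⟩
      γ y₃ * (Δ y₂ * γ y₁)  ≡⟨ swap (γ y₃) (Δ y₂) (γ y₁) ⟩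
      γ y₁ * (Δ y₂ * γ y₃)  ≤⟨ ℤP.*-monoˡ-≤-nonNeg (γ y₁) {{ℤ.nonNegative (ℤP.<⇒≤ 0<γ₁)}} y₂≼y₃ ⟩
      γ y₁ * (Δ y₃ * γ y₂)  ≡⟨ swap (γ y₁) (Δ y₃) (γ y₂) ⟩
      γ y₂ * (Δ y₃ * γ y₁)  ∎)
    where
    open ℤP.≤-Reasoning
    swap : ∀ p d q → p * (d * q) ≡ q * (d * p)
    swap = solve-∀

  module Steepest (y* : Full n) (y*-improving : Improving y*) (y*-least : ∀ y → Improving y → y* ≼ y) where

    a b : ℤ
    a = γ y*
    b = Δ y*

    0<a : + 0 < a
    0<a = proj₂ y*-improving

    w : Vec ℤ n
    w = zipWith _+_ (map (a *_) (eB x)) (map (+ 2 * b *_) c)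

    key : Full n → ℤ
    key y = b * γ y - a * Δ y

    val-w : ∀ y → val w y ≡ val w x + + 2 * key y
    val-w y = begin
      val w y                                          ≡⟨ val-w-split y ⟩
      a * val (eB x) y + + 2 * b * val c y             ≡⟨ regroup a b (val (eB x) y) (val c y) (val c x) (Δ y) ⟩
      a * (val (eB x) y + + 2 * Δ y) + + 2 * b * val c x + + 2 * key y
                                                       ≡⟨ cong (λ v → a * v + + 2 * b * val c x + + 2 * key y) (val-eB x y) ⟩
      a * val (eB x) x + + 2 * b * val c x + + 2 * key y ≡⟨ cong (_+ + 2 * key y) (val-w-split x) ⟨
      val w x + + 2 * key y                            ∎
      where
      open ≡-Reasoning
      val-w-split : ∀ y → val w y ≡ a * val (eB x) y + + 2 * b * val c y
      val-w-split y = trans (val-+ (map (a *_) (eB x)) (map (+ 2 * b *_) c) y)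
                            (cong₂ _+_ (val-* a (eB x) y) (val-* (+ 2 * b) c y))
      regroup : ∀ a b v cy cx d → a * v + + 2 * b * cy ≡ a * (v + + 2 * d) + + 2 * b * cx + + 2 * (b * (cy - cx) - a * d)
      regroup = solve-∀

    0≤Δ : ∀ y → + 0 ≤ Δ y
    0≤Δ y = +≤+ ℕ.z≤n

    0≤aΔ : ∀ y → + 0 ≤ a * Δ y
    0≤aΔ y = subst (_≤ a * Δ y) (ℤP.*-zeroʳ a) (ℤP.*-monoˡ-≤-nonNeg a {{ℤ.nonNegative (ℤP.<⇒≤ 0<a)}} (0≤Δ y))

    bγ≤0 : ∀ y → γ y ≤ + 0 → b * γ y ≤ + 0
    bγ≤0 y γ≤0 = subst (b * γ y ≤_) (ℤP.*-zeroʳ b) (ℤP.*-monoˡ-≤-nonNeg b {{ℤ.nonNegative (0≤Δ y*)}} γ≤0)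

    key≤0 : ∀ y → Feasible F y → key y ≤ + 0
    key≤0 y y∈F with + 0 ℤ.<? γ y
    ... | yes 0<γ = ℤP.i≤j⇒i-j≤0 (subst (b * γ y ≤_) (ℤP.*-comm (Δ y) a) (y*-least y (y∈F , 0<γ)))
    ... | no ¬0<γ = ℤP.i≤j⇒i-j≤0 (ℤP.≤-trans (bγ≤0 y (ℤP.≮⇒≥ ¬0<γ)) (0≤aΔ y))

    key≡0⇒ : ∀ y → Feasible F y → key y ≡ + 0 → y ≡ x ⊎ Improving y
    key≡0⇒ y y∈F key≡0 with + 0 ℤ.<? γ y
    ... | yes 0<γ = inj₂ (y∈F , 0<γ)
    ... | no ¬0<γ with ℤP.i*j≡0⇒i≡0∨j≡0 a aΔ≡0
      where
      aΔ≡0 : a * Δ y ≡ + 0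
      aΔ≡0 = ℤP.≤-antisym
        (ℤP.≤-trans (ℤP.≤-reflexive (sym (ℤP.i-j≡0⇒i≡j _ _ key≡0))) (bγ≤0 y (ℤP.≮⇒≥ ¬0<γ))) (0≤aΔ y)
    ...   | inj₁ a≡0 = ⊥-elim (ℤP.<⇒≢ 0<a (sym a≡0))
    ...   | inj₂ Δ≡0 = inj₁ (sym (dist≡0⇒≡ x y (ℤP.+-injective Δ≡0)))

    key-y* : key y* ≡ + 0
    key-y* = cancel a b
      where
      cancel : ∀ a b → b * a - a * b ≡ + 0
      cancel = solve-∀

    y*≢x : y* ≢ x
    y*≢x refl = ℤP.<⇒≢ 0<a (sym (ℤP.+-inverseʳ (val c x)))

    Tie : Full n → Set
    Tie y = Feasible F y × key y ≡ + 0 × y ≢ x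

    tie? : Decidable Tie
    tie? y = (F y Bool.≟ true) ×-dec (key y ℤ.≟ + 0) ×-dec ¬? (VecP.≡-dec BoolP._≟_ y x)

    module Nearest (z : Full n) (z-tie : Tie z) (z-nearest : ∀ y → Tie y → dist x z ℕ.≤ dist x y) where

      W : Vec ℤ n
      W = zipWith _+_ w (agreement x z)

      drop : Full n → ℤ
      drop y = + leaving x z y - key y

      0≤drop : ∀ y → Feasible F y → + 0 ≤ drop y
      0≤drop y y∈F = ℤP.+-mono-≤ (+≤+ ℕ.z≤n) (ℤP.neg-mono-≤ (key≤0 y y∈F))

      val-W : ∀ y → val W y + + 2 * drop y ≡ val W x
      val-W y = begin
        val W y + + 2 * drop y
          ≡⟨ cong (_+ + 2 * drop y) (val-+ w (agreement x z) y) ⟩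
        val w y + val (agreement x z) y + + 2 * drop y
          ≡⟨ cong (λ v → v + val (agreement x z) y + + 2 * drop y) (val-w y) ⟩
        val w x + + 2 * key y + val (agreement x z) y + + 2 * drop y
          ≡⟨ regroup (val w x) (key y) (val (agreement x z) y) (+ leaving x z y) ⟩
        val w x + (val (agreement x z) y + + 2 * + leaving x z y)
          ≡⟨ cong (ℤ._+_ (val w x)) (val-agreement x z y) ⟩
        val w x + val (agreement x z) x
          ≡⟨ val-+ w (agreement x z) x ⟨
        val W x ∎
        where
        open ≡-Reasoning
        regroup : ∀ v k g l → v + + 2 * k + g + + 2 * (l - k) ≡ v + (g + + 2 * l)
        regroup = solve-∀

      W-maximal : ∀ C → Feasible F C → val W C ≤ val W x
      W-maximal C C∈F = subst (val W C ≤_) (val-W C)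
        (ℤP.i≤i+j (val W C) (+ 2 * drop C) {{ℤ.nonNegative (ℤP.*-monoˡ-≤-nonNeg (+ 2) (0≤drop C C∈F))}})

      W-tie : val W x ≡ val W z
      W-tie = trans (sym (val-W z)) (trans (cong (λ d → val W z + + 2 * d) drop-z) (ℤP.+-identityʳ (val W z)))
        where
        drop-z : drop z ≡ + 0
        drop-z = cong₂ (λ l k → + l - k) (leaving-self x z) (proj₁ (proj₂ z-tie))

      W-only : ∀ C → Feasible F C → val W C ≡ val W x → C ≡ x ⊎ C ≡ z
      W-only C C∈F val-C≡ with VecP.≡-dec BoolP._≟_ C x
      ... | yes C≡x = inj₁ C≡x
      ... | no C≢x  =
        inj₂ (not-leaving∧dist≥⇒≡ x z C (ℤP.+-injective leaving≡0) (z-nearest C (C∈F , key≡0 , C≢x)))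
        where
        2drop≡0 : + 2 * drop C ≡ + 0
        2drop≡0 = begin
          + 2 * drop C                         ≡⟨ i+j-i≡j (val W C) (+ 2 * drop C) ⟨
          val W C + + 2 * drop C - val W C     ≡⟨ cong₂ _-_ (val-W C) val-C≡ ⟩
          val W x - val W x                    ≡⟨ ℤP.+-inverseʳ (val W x) ⟩
          + 0                                  ∎
          where open ≡-Reasoning
        parts≡0 = 0≤i→0≤j→i+j≤0⇒i≡0∧j≡0 (+≤+ ℕ.z≤n) (ℤP.neg-mono-≤ (key≤0 C C∈F))
                    (ℤP.≤-reflexive (ℤP.*-cancelˡ-≡ (+ 2) (drop C) (+ 0) 2drop≡0))
        leaving≡0 : + leaving x z C ≡ + 0
        leaving≡0 = proj₁ parts≡0
        key≡0 : key C ≡ + 0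
        key≡0 = trans (sym (ℤP.neg-involutive (key C))) (cong -_ (proj₂ parts≡0))

      edge : IsEdge F x z
      edge = x∈F , proj₁ z-tie , ≢-sym (proj₂ (proj₂ z-tie)) , W , W-maximal , W-tie , W-only

      improves : val c x < val c z
      improves with key≡0⇒ z (proj₁ z-tie) (proj₁ (proj₂ z-tie))
      ... | inj₁ z≡x = ⊥-elim (proj₂ (proj₂ z-tie) z≡x)
      ... | inj₂ (_ , 0<γ) =
        subst₂ _<_ (ℤP.+-identityˡ (val c x)) (i-j+j≡i (val c z) (val c x)) (ℤP.+-monoˡ-< (val c x) 0<γ)

improving-edge : ∀ {n} (F : Full n → Bool) {x} → Feasible F x → (c : Vec ℤ n) →
  ∀ {y} → Feasible F y → val c x < val c y → ∃ λ z → IsEdge F x z × val c x < val c z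
improving-edge {n} F {x} x∈F c {y} y∈F cx<cy = z , Z.edge , Z.improves
  where
  open ImprovingEdge F x∈F c
  steepest : ∃ λ y* → Improving y* × ∀ y → Improving y → y* ≼ y
  steepest = least improving? _≼_ (λ _ _ → ℤP.≤-total _ _) ≼-trans (enumFull n)
               (y , y∈F , subst (_< γ y) (ℤP.+-inverseʳ (val c x)) (ℤP.+-monoˡ-< (- val c x) cx<cy))
  open Steepest (proj₁ steepest) (proj₁ (proj₂ steepest)) (proj₂ (proj₂ steepest))
  nearest : ∃ λ z → Tie z × ∀ y → Tie y → dist x z ℕ.≤ dist x y
  nearest = least tie? (λ u v → dist x u ℕ.≤ dist x v) (λ _ _ → ℕP.≤-total _ _) (λ _ _ _ → ℕP.≤-trans)
                  (enumFull n) (proj₁ steepest , proj₁ (proj₁ (proj₂ steepest)) , key-y* , y*≢x)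
  z = proj₁ nearest
  module Z = Nearest z (proj₁ (proj₂ nearest)) (proj₂ (proj₂ nearest))

-- From a delta-matroid to the axioms

-- The effect of changing one coordinate of a basis on (|S∩T ∩ B|, |S⊔T ∩ B|): the first changes only
-- together with the second, in the same direction (point-or-absent).
data Move : Set where
  still up-⊔ down-⊔ up-both down-both : Move

Δ∩ Δ⊔ : Move → ℤ
Δ∩ up-both   = + 1
Δ∩ down-both = -[1+ 0 ]
Δ∩ _         = + 0
Δ⊔ still     = + 0
Δ⊔ up-⊔      = + 1
Δ⊔ down-⊔    = -[1+ 0 ]
Δ⊔ up-both   = + 1
Δ⊔ down-both = -[1+ 0 ]

enumMove : Enumeration Move
enumMove = record
  { elements = still ∷ up-⊔ ∷ down-⊔ ∷ up-both ∷ down-both ∷ []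
  ; complete = λ { still → here refl ; up-⊔ → there (here refl) ; down-⊔ → there (there (here refl))
                 ; up-both → there (there (there (here refl))) ; down-both → there (there (there (there (here refl)))) } }

Improves : Move → Move → Set
Improves m₁ m₂ = (+ 0 < Δ∩ m₁ + Δ∩ m₂ ⊎ + 0 < Δ⊔ m₁ + Δ⊔ m₂) →
                 + 0 < (Δ∩ m₁ + Δ∩ m₂) + (Δ⊔ m₁ + Δ⊔ m₂)

-- Decided by evaluation. Two moves are all an edge of a delta-matroid allows; for three the claim fails.
two-moves-improve : ∀ m₁ m₂ → Improves m₁ m₂
two-moves-improve = from-yes (all? enumMove λ m₁ → all? enumMove λ m₂ →
  ((+ 0 ℤ.<? Δ∩ m₁ + Δ∩ m₂) ⊎-dec (+ 0 ℤ.<? Δ⊔ m₁ + Δ⊔ m₂)) →-dec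
  (+ 0 ℤ.<? (Δ∩ m₁ + Δ∩ m₂) + (Δ⊔ m₁ + Δ⊔ m₂)))

move : ∀ s t a b → Σ Move λ m → gain (∩₁ s t) a b ≡ Δ∩ m × gain (⊔₁ s t) a b ≡ Δ⊔ m
move s t a b with point-or-absent s t
... | inj₁ ∩≡nothing with gain-values (⊔₁ s t) a b
...   | inj₁ g≡0         = still  , cong (λ r → gain r a b) ∩≡nothing , g≡0
...   | inj₂ (inj₁ g≡1)  = up-⊔   , cong (λ r → gain r a b) ∩≡nothing , g≡1
...   | inj₂ (inj₂ g≡-1) = down-⊔ , cong (λ r → gain r a b) ∩≡nothing , g≡-1
move s t a b | inj₂ ⊔≡∩ with gain-values (∩₁ s t) a b
...   | inj₁ g≡0         = still     , g≡0  , trans (cong (λ r → gain r a b) ⊔≡∩) g≡0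
...   | inj₂ (inj₁ g≡1)  = up-both   , g≡1  , trans (cong (λ r → gain r a b) ⊔≡∩) g≡1
...   | inj₂ (inj₂ g≡-1) = down-both , g≡-1 , trans (cong (λ r → gain r a b) ⊔≡∩) g≡-1

sign : Maybe Bool → ℤ
sign nothing      = + 0
sign (just true)  = + 1
sign (just false) = -[1+ 0 ]

signed : ∀ {n} → AdS n → Vec ℤ n
signed = map sign

val-signed : ∀ {n} (U : AdS n) (y : Full n) → val (signed U) y + + card U ≡ + 2 * + meet U y
val-signed []      []      = refl
val-signed (s ∷ U) (b ∷ y) = begin
  sign s * eb b + val (signed U) y + + card (s ∷ U)
    ≡⟨ cong (λ k → sign s * eb b + val (signed U) y + k) (trans (cong +_ (card-∷ s U)) (ℤP.pos-+ (size s) (card U))) ⟩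
  sign s * eb b + val (signed U) y + (+ size s + + card U)
    ≡⟨ ℤ-+.interchange (sign s * eb b) (val (signed U) y) (+ size s) (+ card U) ⟩
  (sign s * eb b + + size s) + (val (signed U) y + + card U)
    ≡⟨ cong₂ _+_ (coordinate s b) (val-signed U y) ⟩
  + 2 * + hit s b + + 2 * + meet U y
    ≡⟨ ℤP.*-distribˡ-+ (+ 2) (+ hit s b) (+ meet U y) ⟨
  + 2 * (+ hit s b + + meet U y)
    ≡⟨ cong (+ 2 *_) (ℤP.pos-+ (hit s b) (meet U y)) ⟨
  + 2 * + (hit s b ℕ.+ meet U y) ∎
  where
  open ≡-Reasoning
  coordinate : ∀ s b → sign s * eb b + + size s ≡ + 2 * + hit s b
  coordinate nothing      true  = refl
  coordinate nothing      false = refl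
  coordinate (just true)  true  = refl
  coordinate (just true)  false = refl
  coordinate (just false) true  = refl
  coordinate (just false) false = refl

signed-<⇔meet-< : ∀ {n} (U : AdS n) (x y : Full n) → val (signed U) x < val (signed U) y ⇔ meet U x ℕ.< meet U y
signed-<⇔meet-< U x y = mk⇔
  (λ lt → ℤP.drop‿+<+ (ℤP.*-cancelˡ-<-nonNeg (+ 2)
            (subst₂ _<_ (val-signed U x) (val-signed U y) (ℤP.+-monoˡ-< (+ card U) lt))))
  (λ lt → +-cancelʳ-< (+ card U)
            (subst₂ _<_ (sym (val-signed U x)) (sym (val-signed U y)) (ℤP.*-monoˡ-<-pos (+ 2) (+<+ lt))))

meet-two-updates : ∀ {n} (A : AdS n) (x z : Full n) i j → z ≡ x [ i ]≔ lookup z i [ j ]≔ lookup z j →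
  + meet A z ≡ + meet A x + (gain (lookup A i) (lookup x i) (lookup z i)
                             + gain (lookup A j) (lookup (x [ i ]≔ lookup z i) j) (lookup z j))
meet-two-updates A x z i j z≡ = begin
  + meet A z                                ≡⟨ cong (λ v → + meet A v) z≡ ⟩
  + meet A (y [ j ]≔ lookup z j)            ≡⟨ meet-update A y j (lookup z j) ⟩
  + meet A y + gⱼ                           ≡⟨ cong (_+ gⱼ) (meet-update A x i (lookup z i)) ⟩
  + meet A x + gᵢ + gⱼ                      ≡⟨ ℤP.+-assoc (+ meet A x) gᵢ gⱼ ⟩
  + meet A x + (gᵢ + gⱼ)                    ∎
  where
  open ≡-Reasoning
  y = x [ i ]≔ lookup z i
  gᵢ = gain (lookup A i) (lookup x i) (lookup z i)
  gⱼ = gain (lookup A j) (lookup y j) (lookup z j)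

covered-moves : ∀ {n} (S T : AdS n) (x z : Full n) {i j} → Covers x z i j →
  Σ Move λ m₁ → Σ Move λ m₂ → (+ meet (S ∩ T) z ≡ + meet (S ∩ T) x + (Δ∩ m₁ + Δ∩ m₂))
                            × (+ meet (S ⊔ T) z ≡ + meet (S ⊔ T) x + (Δ⊔ m₁ + Δ⊔ m₂))
covered-moves S T x z {i} {j} cov = m₁ , m₂ , ∩-step , ⊔-step
  where
  z≡ = covers⇒two-updates x z cov
  yⱼ = lookup (x [ i ]≔ lookup z i) j
  mv₁ = move (lookup S i) (lookup T i) (lookup x i) (lookup z i)
  mv₂ = move (lookup S j) (lookup T j) yⱼ (lookup z j)
  m₁ = proj₁ mv₁
  m₂ = proj₁ mv₂
  ∩-step : + meet (S ∩ T) z ≡ + meet (S ∩ T) x + (Δ∩ m₁ + Δ∩ m₂)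
  ∩-step = trans (meet-two-updates (S ∩ T) x z i j z≡) (cong (ℤ._+_ (+ meet (S ∩ T) x)) (cong₂ _+_
    (trans (cong (λ r → gain r (lookup x i) (lookup z i)) (lookup-∩ S T i)) (proj₁ (proj₂ mv₁)))
    (trans (cong (λ r → gain r yⱼ (lookup z j)) (lookup-∩ S T j)) (proj₁ (proj₂ mv₂)))))
  ⊔-step : + meet (S ⊔ T) z ≡ + meet (S ⊔ T) x + (Δ⊔ m₁ + Δ⊔ m₂)
  ⊔-step = trans (meet-two-updates (S ⊔ T) x z i j z≡) (cong (ℤ._+_ (+ meet (S ⊔ T) x)) (cong₂ _+_
    (trans (cong (λ r → gain r (lookup x i) (lookup z i)) (lookup-⊔ S T i)) (proj₂ (proj₂ mv₁)))
    (trans (cong (λ r → gain r yⱼ (lookup z j)) (lookup-⊔ S T j)) (proj₂ (proj₂ mv₂)))))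

module _ {n} {F : Full n → Bool} (D : IsDeltaMatroid F) (S T : AdS n) where

  private
    U = S ∩ T
    W = S ⊔ T

  φ : Full n → ℕ
  φ y = meet U y ℕ.+ meet W y

  module _ {x : Full n} (x∈F : Feasible F x) (x-max : ∀ y → Feasible F y → φ y ℕ.≤ φ x) where

    edge-gains-nothing : ∀ {z} → IsEdge F x z → ¬ (meet U x ℕ.< meet U z ⊎ meet W x ℕ.< meet W z)
    edge-gains-nothing {z} e gains with covered-moves S T x z (proj₂ (proj₂ (direction⇒covers (proj₂ D x z e))))
    ... | m₁ , m₂ , U-step , W-step =
      ℕP.<⇒≱ (+a≡+b+δ⇒0<δ⇒b<a φ-step (two-moves-improve m₁ m₂ U-or-W-gains)) (x-max z (proj₁ (proj₂ e)))
      where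
      δU = Δ∩ m₁ + Δ∩ m₂
      δW = Δ⊔ m₁ + Δ⊔ m₂
      U-or-W-gains : + 0 < δU ⊎ + 0 < δW
      U-or-W-gains = Sum.map (+a≡+b+δ⇒b<a⇒0<δ U-step) (+a≡+b+δ⇒b<a⇒0<δ W-step) gains
      φ-step : + φ z ≡ + φ x + (δU + δW)
      φ-step = begin
        + φ z                                  ≡⟨ ℤP.pos-+ (meet U z) (meet W z) ⟩
        + meet U z + + meet W z                ≡⟨ cong₂ _+_ U-step W-step ⟩
        + meet U x + δU + (+ meet W x + δW)    ≡⟨ ℤ-+.interchange (+ meet U x) δU (+ meet W x) δW ⟩
        + meet U x + + meet W x + (δU + δW)    ≡⟨ cong (_+ (δU + δW)) (ℤP.pos-+ (meet U x) (meet W x)) ⟨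
        + φ x + (δU + δW)                      ∎
        where open ≡-Reasoning

    maximizes : ∀ A → (∀ {z} → IsEdge F x z → ¬ meet A x ℕ.< meet A z) →
                ∀ y → Feasible F y → meet A y ℕ.≤ meet A x
    maximizes A no-gain y y∈F with meet A y ℕ.≤? meet A x
    ... | yes ≤ = ≤
    ... | no ≰ =
      ⊥-elim (no-gain (proj₁ (proj₂ up)) (Equivalence.to (signed-<⇔meet-< A x (proj₁ up)) (proj₂ (proj₂ up))))
      where
      up : ∃ λ z → IsEdge F x z × val (signed A) x < val (signed A) z
      up = improving-edge F x∈F (signed A) y∈F (Equivalence.from (signed-<⇔meet-< A x y) (ℕP.≰⇒> ≰))

    maximizes-∩ : ∀ y → Feasible F y → meet U y ℕ.≤ meet U x
    maximizes-∩ = maximizes U λ e gain → edge-gains-nothing e (inj₁ gain)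

    maximizes-⊔ : ∀ y → Feasible F y → meet W y ℕ.≤ meet W x
    maximizes-⊔ = maximizes W λ e gain → edge-gains-nothing e (inj₂ gain)

maxMeet-at : ∀ {n} {F : Full n → Bool} A {v x} → MaxMeet F A v → Feasible F x →
  (∀ y → Feasible F y → meet A y ℕ.≤ meet A x) → v ≡ + meet A x
maxMeet-at _ ((B , B∈F , meet≡v) , meet≤v) x∈F x-max =
  ℤP.≤-antisym (subst (_≤ _) meet≡v (+≤+ (x-max B B∈F))) (meet≤v _ x∈F)

deltaMatroid⇒axioms : ∀ {n} {F : Full n → Bool} {h : AdS n → ℤ} → IsDeltaMatroid F →
  (∀ S → IsHValue F S (h S)) → HAxioms h
deltaMatroid⇒axioms {n} {F} {h} D h-value = empty , singleton , submodular
  where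
  max-meet : ∀ S → MaxMeet F S (h S)
  max-meet S = hValue⇒maxMeet F S (h S) (h-value S)

  empty : h ∅ ≡ + 0
  empty with proj₁ (max-meet ∅)
  ... | B , _ , meet≡h = trans (sym meet≡h) (cong +_ (meet-∅ B))

  singleton : ∀ S → card S ≡ 1 → h S ≡ + 0 ⊎ h S ≡ + 1
  singleton S |S|≡1 with proj₁ (max-meet S)
  ... | B , _ , meet≡h = Sum.map (trans (sym meet≡h)) (trans (sym meet≡h))
    (0≤i≤1⇒i∈01 (+≤+ ℕ.z≤n) (+≤+ (subst (meet S B ℕ.≤_) |S|≡1 (meet≤card S B))))

  submodular : ∀ S T → h (S ∩ T) + h (S ⊔ T) + + card (S ∩ bar T) ≤ h S + h T
  submodular S T = begin
    h (S ∩ T) + h (S ⊔ T) + + card (S ∩ bar T)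
      ≡⟨ cong₂ (λ a b → a + b + + card (S ∩ bar T))
               (maxMeet-at (S ∩ T) (max-meet (S ∩ T)) x∈F (maximizes-∩ D S T x∈F x-max))
               (maxMeet-at (S ⊔ T) (max-meet (S ⊔ T)) x∈F (maximizes-⊔ D S T x∈F x-max)) ⟩
    + meet (S ∩ T) x + + meet (S ⊔ T) x + + card (S ∩ bar T)
      ≡⟨ pos-+₃ (meet (S ∩ T) x) (meet (S ⊔ T) x) (card (S ∩ bar T)) ⟨
    + (meet (S ∩ T) x ℕ.+ meet (S ⊔ T) x ℕ.+ card (S ∩ bar T))
      ≡⟨ cong +_ (meet-modular S T x) ⟩
    + (meet S x ℕ.+ meet T x)
      ≡⟨ ℤP.pos-+ (meet S x) (meet T x) ⟩
    + meet S x + + meet T x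
      ≤⟨ ℤP.+-mono-≤ (proj₂ (max-meet S) x x∈F) (proj₂ (max-meet T) x x∈F) ⟩
    h S + h T ∎
    where
    open ℤP.≤-Reasoning
    maximum : ∃ λ x → Feasible F x × ∀ y → Feasible F y → φ D S T y ℕ.≤ φ D S T x
    maximum = least (λ y → F y Bool.≟ true) (λ a b → φ D S T b ℕ.≤ φ D S T a) (λ _ _ → ℕP.≤-total _ _)
                    (λ _ _ _ p q → ℕP.≤-trans q p) (enumFull n) (proj₁ D)
    x = proj₁ maximum
    x∈F = proj₁ (proj₂ maximum)
    x-max = proj₂ (proj₂ maximum)

corollary2p9 : (n : ℕ) (h : AdS n → ℤ) →
    (Σ (Full n → Bool) λ F → IsDeltaMatroid F × (∀ S → IsHValue F S (h S)))
    ⇔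
    ((h ∅ ≡ + 0) ×
     (∀ S → card S ≡ 1 → h S ≡ + 0 ⊎ h S ≡ + 1) ×
     (∀ S T → h (S ∩ T) + h (S ⊔ T) + + card (S ∩ bar T) ≤ h S + h T))
corollary2p9 n h = mk⇔ (λ (F , D , h-value) → deltaMatroid⇒axioms D h-value) axioms⇒deltaMatroid
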